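{- Let $t\ge 1$ and $N\ge 3$ be integers, let $S_{1^t}$ be the star with $t$ leaves and $u$ its central vertex. For every $k\ge 0$, $\mathcal{G}_{I_N}(S_{1^t}\oplus_u P_k)=\mathcal{G}_{I_N}(S_{1^t}\oplus_u P_{k \bmod (N+1)})$. In particular $k\mapsto \mathcal{G}_{I_N}(S_{1^t}\oplus_u P_k)$ is purely periodic with period $N+1$.
   Context: $I_N=\{1,\ldots,N\}$. For a set $L$ of positive integers, the game $CSG(L)$ on a connected graph $G$ is the two-player impartial game in which a move consists in removing from the current graph a connected subgraph $H$ such that $|V(H)|\in L$ and the remaining graph is connected (the empty graph counts as connected, so removing the whole graph is allowed when its size is in $L$). The player unable to move loses. $\mathcal{G}_L(G)$ is the Grundy value of $CSG(L)$ on $G$. $P_k$ is the path on $k$ vertices; $G\oplus_u P_k$ is obtained from $G$ by appending a path of $k$ new vertices to $u$ (an endpoint of the path adjacent to $u$, $u$ not part of the path). -}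

module Defs where

open import Data.Bool using (Bool; true; false; _∧_; _∨_; not; if_then_else_)
open import Data.Nat using (ℕ; zero; suc; _+_; _≤ᵇ_; _≡ᵇ_)
open import Data.Fin using (Fin; toℕ)
open import Data.Fin.Subset using (Subset; inside; outside; _─_; ∣_∣)
open import Data.List using (List; []; _∷_; map; concatMap; filter)
open import Data.Bool.ListAction using (any)
open import Data.Bool using (T?)
open import Data.Vec using (Vec; []; _∷_; tabulate; lookup; toList; zipWith; foldr)
open import Function using (_∘_)
open import Relation.Binary.PropositionalEquality using (_≡_)

-- Positions of the game are vertex subsets of a
-- fixed graph (the position is the induced subgraph on that subset).

Graph : ℕ → Set
Graph n = Fin n → Fin n → Bool

subsetsOf : ∀ {n} → Subset n → List (Subset n)
subsetsOf [] = [] ∷ []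
subsetsOf (inside ∷ s) =
  concatMap (λ x → (inside ∷ x) ∷ (outside ∷ x) ∷ []) (subsetsOf s)
subsetsOf (outside ∷ s) = map (outside ∷_) (subsetsOf s)

firstElem : ∀ {n} → Subset n → Subset n
firstElem [] = []
firstElem (inside ∷ s) = inside ∷ Data.Vec.replicate _ outside
firstElem (outside ∷ s) = outside ∷ firstElem s

isEmptyᵇ : ∀ {n} → Subset n → Bool
isEmptyᵇ s = foldr _ (λ b r → not b ∧ r) true s

eqSubᵇ : ∀ {n} → Subset n → Subset n → Bool
eqSubᵇ [] [] = true
eqSubᵇ (a ∷ s) (b ∷ t) = (a ∧ b ∨ not a ∧ not b) ∧ eqSubᵇ s t

step : ∀ {n} → Graph n → Subset n → Subset n → Subset n
step {n} G S A = tabulate λ w →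
  lookup A w ∨ (lookup S w ∧ any (λ v → lookup A v ∧ G v w) (toList (tabulate {n = n} (λ v → v))))

iter : ∀ {n} → ℕ → (Subset n → Subset n) → Subset n → Subset n
iter zero f a = a
iter (suc k) f a = iter k f (f a)

-- S induces a connected subgraph of G (the empty graph counts as connected):
-- the set of vertices reachable inside S from the first vertex of S is all of S.
-- (n expansion steps suffice since a path in S has fewer than n edges.)
connectedᵇ : ∀ {n} → Graph n → Subset n → Bool
connectedᵇ {n} G S = isEmptyᵇ S ∨ eqSubᵇ (iter n (step G S) (firstElem S)) S

-- The game CSG(L): from position S, remove X ⊆ S with |X| ∈ L such that
-- X and S ─ X both induce connected subgraphs.

options : ∀ {n} → (ℕ → Bool) → Graph n → Subset n → List (Subset n)
options L G S =
  map (λ X → S ─ X)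
    (filter (λ X → T? (not (isEmptyᵇ X) ∧ L ∣ X ∣
                                 ∧ connectedᵇ G X ∧ connectedᵇ G (S ─ X)))
            (subsetsOf S))

memᵇ : ℕ → List ℕ → Bool
memᵇ m xs = any (m ≡ᵇ_) xs

mexFrom : ℕ → ℕ → List ℕ → ℕ
mexFrom zero m xs = m
mexFrom (suc f) m xs = if memᵇ m xs then mexFrom f (suc m) xs else m

mex : List ℕ → ℕ
mex xs = mexFrom (Data.List.length xs) 0 xs

-- Grundy value with fuel; every move removes at least one vertex, so
-- fuel |S| + 1 is enough to reach the terminal positions.
grundyF : ∀ {n} → ℕ → (ℕ → Bool) → Graph n → Subset n → ℕ
grundyF zero L G S = 0
grundyF (suc f) L G S = mex (map (grundyF f L G) (options L G S))

𝒢 : ∀ {n} → (ℕ → Bool) → Graph n → ℕ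
𝒢 {n} L G = grundyF (suc n) L G (Data.Vec.replicate n inside)

I : ℕ → ℕ → Bool
I N m = (1 ≤ᵇ m) ∧ (m ≤ᵇ N)

-- S_{1^t} ⊕_u P_k on vertex set Fin (1 + t + k):
--   vertex 0 = u (centre), vertices 1..t = leaves,
--   vertices t+1, …, t+k = the appended path, t+1 adjacent to u,
--   t+i adjacent to t+i+1.
edgeℕ : ℕ → ℕ → ℕ → Bool
edgeℕ t a b = ((a ≡ᵇ 0) ∧ (1 ≤ᵇ b) ∧ (b ≤ᵇ suc t))
            ∨ ((suc t ≤ᵇ a) ∧ (b ≡ᵇ suc a))

starPath : (t k : ℕ) → Graph (suc (t + k))
starPath t k i j = edgeℕ t (toℕ i) (toℕ j) ∨ edgeℕ t (toℕ j) (toℕ i)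

module Submission where

open import Defs
open import Data.Nat using (ℕ; suc; _≤_; _<_; _%_; s≤s; z≤n)
open import Data.Nat.Properties using (≤-trans)
open import Relation.Binary.PropositionalEquality using (_≡_)

-- Every position of CSG(I_N) reached from S_{1^t} ⊕_u P_k is a star-path (the centre, some leaves and
-- an initial part of the path, i.e. a copy of S_{1^s} ⊕_u P_j) or a segment (a copy of P_m): a
-- removable connected set with connected complement is everything, one leaf, a tail of the path, or
-- everything but one leaf or a final part of the path.  By induction on the size of a position, a
-- segment has Grundy value m mod (N+1) and a star-path has Q(s, j) := 𝒢(S_{1^s} ⊕_u P_j), so Q obeys
-- a mex recurrence in Q and residues mod N+1 only.  That recurrence forces Q(s, j + N + 1) = Q(s, j),
-- by induction on s and j: with Q(s, j) ≤ s + j + 1, Q(s, j) = 0 for s + j = N and Q(s, j) = 1 for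
-- s + j = N + 1, lengthening the path by N + 1 neither creates an option of value Q(s, j) nor loses
-- an option of smaller value.

module Mex where

  open import Data.Bool using (true; false)
  open import Data.Bool.Properties using (T-≡)
  open import Data.Nat
  open import Data.Nat.Properties
  open import Data.Fin using (Fin; toℕ)
  open import Data.Fin.Properties using (toℕ<n; pigeonhole)
  open import Data.List using (List; length; lookup)
  open import Data.List.Membership.Propositional using (_∈_)
  open import Data.List.Relation.Unary.Any as Any using (index)
  open import Data.List.Relation.Unary.Any.Properties using (any⁺; any⁻; lookup-index)
  open import Data.Product using (_×_; _,_)
  open import Data.Sum using (_⊎_; inj₁; inj₂; map₂)
  open import Function using (_∘_; _⇔_; Equivalence)
  open import Relation.Nullary using (¬_; yes; no; contradiction)
  open import Relation.Binary using (tri<; tri≈; tri>)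
  open import Relation.Binary.PropositionalEquality

  IsMex : (ℕ → Set) → ℕ → Set
  IsMex P v = ¬ P v × (∀ w → w < v → P w)

  IsMex-unique : ∀ {P v v′} → IsMex P v → IsMex P v′ → v ≡ v′
  IsMex-unique {v = v} {v′} (∉v , <v) (∉v′ , <v′) with <-cmp v v′
  ... | tri< v<v′ _ _ = contradiction (<v′ v v<v′) ∉v
  ... | tri≈ _ v≡v′ _ = v≡v′
  ... | tri> _ _ v′<v = contradiction (<v v′ v′<v) ∉v′

  IsMex-≤ : ∀ {P v} b → IsMex P v → (∀ w → P w → w ≤ b) → v ≤ suc b
  IsMex-≤ {v = v} b (_ , <v) bounded with v ≤? suc b
  ... | yes v≤ = v≤
  ... | no v≰ = contradiction (bounded (suc b) (<v (suc b) (≰⇒> v≰))) (<⇒≱ ≤-refl)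

  IsMex-resp-⇔ : ∀ {P P′ v} → (∀ w → P w ⇔ P′ w) → IsMex P v → IsMex P′ v
  IsMex-resp-⇔ P⇔P′ (∉v , <v) =
    ∉v ∘ Equivalence.from (P⇔P′ _) , λ w w<v → Equivalence.to (P⇔P′ w) (<v w w<v)

  memᵇ⇔∈ : ∀ m xs → memᵇ m xs ≡ true ⇔ m ∈ xs
  memᵇ⇔∈ m xs = record
    { to = Any.map (≡ᵇ⇒≡ m _) ∘ any⁻ (m ≡ᵇ_) xs ∘ Equivalence.from T-≡
    ; from = Equivalence.to T-≡ ∘ any⁺ (m ≡ᵇ_) ∘ Any.map (≡⇒≡ᵇ m _)
    ; to-cong = cong _
    ; from-cong = cong _
    }

  all<∈⇒≤length : ∀ xs v → (∀ w → w < v → w ∈ xs) → v ≤ length xs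
  all<∈⇒≤length xs v all<∈ = ≮⇒≥ no-injection
    where
    no-injection : ¬ length xs < v
    no-injection len<v =
      let (i , j , i<j , same-index) = pigeonhole (n<1+n (length xs)) (index ∘ ∈xs)
      in <⇒≢ i<j (trans (lookup-index (∈xs i)) (trans (cong (lookup xs) same-index) (sym (lookup-index (∈xs j)))))
      where
      ∈xs : (w : Fin (suc (length xs))) → toℕ w ∈ xs
      ∈xs w = all<∈ (toℕ w) (≤-<-trans (≤-pred (toℕ<n w)) len<v)

  mexFrom-scan : ∀ fuel m xs → let v = mexFrom fuel m xs in
    m ≤ v × (∀ w → m ≤ w → w < v → w ∈ xs) × (¬ v ∈ xs ⊎ v ≡ m + fuel)
  mexFrom-scan zero m xs = ≤-refl , (λ w m≤w w<m → contradiction w<m (≤⇒≯ m≤w)) , inj₂ (sym (+-identityʳ m))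
  mexFrom-scan (suc fuel) m xs with memᵇ m xs in m∈?
  ... | false = ≤-refl , (λ w m≤w w<m → contradiction w<m (≤⇒≯ m≤w)) ,
                inj₁ λ m∈ → contradiction (trans (sym m∈?) (Equivalence.from (memᵇ⇔∈ m xs) m∈)) λ ()
  ... | true with mexFrom-scan fuel (suc m) xs
  ... | m<v , between , ∉v⊎v≡ = ≤-trans (n≤1+n m) m<v , between′ , map₂ (λ v≡ → trans v≡ (sym (+-suc m fuel))) ∉v⊎v≡
    where
    between′ : ∀ w → m ≤ w → w < mexFrom fuel (suc m) xs → w ∈ xs
    between′ w m≤w w<v with m≤n⇒m<n∨m≡n m≤w
    ... | inj₁ m<w = between w m<w w<v
    ... | inj₂ refl = Equivalence.to (memᵇ⇔∈ m xs) m∈?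

  -- When the scan runs out of fuel its result is length xs, which then lies outside xs as well:
  -- otherwise xs would contain length xs + 1 distinct values.
  mex-IsMex : ∀ xs → IsMex (_∈ xs) (mex xs)
  mex-IsMex xs with mexFrom-scan (length xs) 0 xs
  ... | _ , below , inj₁ ∉v = ∉v , λ w → below w z≤n
  ... | _ , below , inj₂ v≡len = ∉v , λ w → below w z≤n
    where
    ∉v : ¬ mex xs ∈ xs
    ∉v v∈ = contradiction (all<∈⇒≤length xs (suc (length xs)) all≤len∈) (<⇒≱ ≤-refl)
      where
      all≤len∈ : ∀ w → w < suc (length xs) → w ∈ xs
      all≤len∈ w w<1+len with m≤n⇒m<n∨m≡n (≤-pred w<1+len)
      ... | inj₁ w<len = below w z≤n (subst (w <_) (sym v≡len) w<len)
      ... | inj₂ refl = subst (_∈ xs) v≡len v∈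

module Recurrence where

  open Mex
  open import Data.Nat
  open import Data.Nat.Properties
  open import Data.Nat.DivMod
  open import Data.Nat.Induction using (<-rec)
  open import Data.Nat.Tactic.RingSolver using (solve-∀)
  open import Data.Product using (_,_; proj₁; proj₂)
  open import Function using (_∘_)
  open import Data.Sum using (inj₁; inj₂)
  open import Relation.Nullary using (¬_; yes; no; contradiction)
  open import Relation.Binary using (tri<; tri≈; tri>)
  open import Relation.Binary.PropositionalEquality

  j∸i<j : ∀ {i j} → 0 < i → i ≤ j → j ∸ i < j
  j∸i<j 0<i i≤j = ∸-monoʳ-< 0<i i≤j

  module StarRecurrence (N : ℕ) (Q : ℕ → ℕ → ℕ) where

    -- The values of the options of S_{1^s} ⊕ P_j, reading Q s j as its Grundy value and m % suc N as
    -- that of P_m: remove everything, one leaf, the last i path vertices, everything but the last m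
    -- path vertices, or everything but one leaf.
    data StarOption (s j w : ℕ) : Set where
      take-all   : s + j < N → w ≡ 0 → StarOption s j w
      take-leaf  : ∀ s′ → s ≡ suc s′ → w ≡ Q s′ j → StarOption s j w
      take-tail  : ∀ i → 0 < i → i ≤ N → i ≤ j → w ≡ Q s (j ∸ i) → StarOption s j w
      leave-path : ∀ m → 0 < m → m ≤ j → s + j < N + m → w ≡ m % suc N → StarOption s j w
      leave-leaf : 0 < s → s + j ≤ N → w ≡ 1 % suc N → StarOption s j w

    module Periodicity (0<N : 0 < N) (Q-IsMex : ∀ s j → IsMex (StarOption s j) (Q s j)) where

      1%[1+N]≡1 : 1 % suc N ≡ 1
      1%[1+N]≡1 = m<n⇒m%n≡m (s≤s 0<N)

      Q≢option : ∀ {s j w} → StarOption s j w → Q s j ≢ w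
      Q≢option o Q≡w = proj₁ (Q-IsMex _ _) (subst (StarOption _ _) (sym Q≡w) o)

      <Q⇒option : ∀ {s j} w → w < Q s j → StarOption s j w
      <Q⇒option w = proj₂ (Q-IsMex _ _) w

      Q>0 : ∀ {s j} → s + j < N → 0 < Q s j
      Q>0 s+j<N = n≢0⇒n>0 (Q≢option (take-all s+j<N refl))

      Q>1 : ∀ {s j} → 0 < s → s + j < N → 1 < Q s j
      Q>1 0<s s+j<N = ≤∧≢⇒< (Q>0 s+j<N) (Q≢option (leave-leaf 0<s (<⇒≤ s+j<N) (sym 1%[1+N]≡1)) ∘ sym)

      Q≡0 : ∀ s j → s + j ≡ N → Q s j ≡ 0
      Q≡0 s j s+j≡N = IsMex-unique (Q-IsMex s j) (0∉ , λ _ ())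
        where
        0∉ : ¬ StarOption s j 0
        0∉ (take-all s+j<N _) = <-irrefl s+j≡N s+j<N
        0∉ (take-leaf s′ refl 0≡Q) = <⇒≢ (Q>0 (≤-reflexive s+j≡N)) 0≡Q
        0∉ (take-tail i 0<i _ i≤j 0≡Q) = <⇒≢ (Q>0 (<-≤-trans (+-monoʳ-< s (j∸i<j 0<i i≤j)) (≤-reflexive s+j≡N))) 0≡Q
        0∉ (leave-path m 0<m m≤j _ 0≡m%) =
          <⇒≢ 0<m (trans 0≡m% (m<n⇒m%n≡m (s≤s (≤-trans m≤j (subst (j ≤_) s+j≡N (m≤n+m j s))))))
        0∉ (leave-leaf _ _ 0≡1%) = <⇒≢ z<s (trans 0≡1% 1%[1+N]≡1)

      Q≡1 : ∀ s j → 0 < s → 2 ≤ j → s + j ≡ suc N → Q s j ≡ 1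
      Q≡1 s j 0<s 2≤j s+j≡1+N = IsMex-unique (Q-IsMex s j) (1∉ , λ { zero _ → 0∈ ; (suc w) (s≤s ()) })
        where
        s+[j∸1]≡N : s + (j ∸ 1) ≡ N
        s+[j∸1]≡N = trans (sym (+-∸-assoc s (≤-trans (s≤s z≤n) 2≤j))) (cong (_∸ 1) s+j≡1+N)
        0∈ : StarOption s j 0
        0∈ = take-tail 1 z<s 0<N (≤-trans (s≤s z≤n) 2≤j) (sym (Q≡0 s (j ∸ 1) s+[j∸1]≡N))
        j≤N : j ≤ N
        j≤N = ≤-pred (subst (suc j ≤_) s+j≡1+N (+-monoˡ-≤ j 0<s))
        1∉ : ¬ StarOption s j 1
        1∉ (take-all s+j<N _) = <-asym (subst (_< N) s+j≡1+N s+j<N) (n<1+n N)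
        1∉ (take-leaf s′ refl 1≡Q) = <⇒≢ z<s (sym (trans 1≡Q (Q≡0 s′ j (suc-injective s+j≡1+N))))
        1∉ (take-tail 1 _ _ _ 1≡Q) = <⇒≢ z<s (sym (trans 1≡Q (Q≡0 s (j ∸ 1) s+[j∸1]≡N)))
        1∉ (take-tail (suc (suc i)) _ _ 2+i≤j 1≡Q) = <⇒≢ (Q>1 0<s shortened) 1≡Q
          where
          x = s + (j ∸ suc (suc i))
          1+x+i≡N : suc (x + i) ≡ N
          1+x+i≡N = suc-injective (begin
            suc (suc (x + i)) ≡⟨ cong suc (+-suc x i) ⟨
            suc (x + suc i)   ≡⟨ +-suc x (suc i) ⟨
            x + suc (suc i)   ≡⟨ +-assoc s _ _ ⟩
            s + (j ∸ suc (suc i) + suc (suc i)) ≡⟨ cong (s +_) (m∸n+n≡m 2+i≤j) ⟩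
            s + j             ≡⟨ s+j≡1+N ⟩
            suc N             ∎)
            where open ≡-Reasoning
          shortened : x < N
          shortened = subst (suc x ≤_) 1+x+i≡N (s≤s (m≤m+n x i))
        1∉ (leave-path m _ m≤j s+j<N+m 1≡m%) = <-irrefl (trans 1≡m% (m<n⇒m%n≡m (s≤s (≤-trans m≤j j≤N)))) 1<m
          where
          1<m : 1 < m
          1<m = +-cancelˡ-< N 1 m (subst (_< N + m) (trans s+j≡1+N (+-comm 1 N)) s+j<N+m)
        1∉ (leave-leaf _ s+j≤N _) = 1+n≰n (subst (_≤ N) s+j≡1+N s+j≤N)

      OneLeafFewer : (ℕ → ℕ → Set) → ℕ → Set
      OneLeafFewer P s = ∀ {s′} → s ≡ suc s′ → ∀ j → P s′ j

      leaf-induction : (P : ℕ → ℕ → Set) → (∀ s → OneLeafFewer P s → ∀ j → P s j) → ∀ s j → P s j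
      leaf-induction P step zero    = step zero λ ()
      leaf-induction P step (suc s) = step (suc s) λ { refl → leaf-induction P step s }

      Q≤1+s+j : ∀ s j → Q s j ≤ suc (s + j)
      Q≤1+s+j = leaf-induction _ λ s leaf-ih →
        <-rec _ λ j tail-ih → IsMex-≤ (s + j) (Q-IsMex s j) (options≤ leaf-ih tail-ih)
        where
        options≤ : ∀ {s j} → OneLeafFewer (λ s j → Q s j ≤ suc (s + j)) s →
                   (∀ {y} → y < j → Q s y ≤ suc (s + y)) → ∀ w → StarOption s j w → w ≤ s + j
        options≤ leaf-ih tail-ih w (take-all _ refl) = z≤n
        options≤ {j = j} leaf-ih tail-ih w (take-leaf s′ refl refl) = leaf-ih refl j
        options≤ {s} leaf-ih tail-ih w (take-tail i 0<i _ i≤j refl) =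
          ≤-trans (tail-ih (j∸i<j 0<i i≤j)) (+-monoʳ-< s (j∸i<j 0<i i≤j))
        options≤ {s} {j} leaf-ih tail-ih w (leave-path m _ m≤j _ refl) = ≤-trans (m%n≤m m (suc N)) (≤-trans m≤j (m≤n+m j s))
        options≤ {s} {j} leaf-ih tail-ih w (leave-leaf 0<s _ refl) = ≤-trans (≤-reflexive 1%[1+N]≡1) (≤-trans 0<s (m≤m+n s j))

      private
        shifted≡ : ∀ s j → s + (j + suc N) ≡ N + suc (s + j)
        shifted≡ s j = lemma s j N
          where
          lemma : ∀ s j N → s + (j + suc N) ≡ N + suc (s + j)
          lemma = solve-∀

      -- For j = 0 the lone leaf left behind in (s, 0) is matched in (s, N + 1) by cutting s path
      -- vertices, reaching a position of value 1 by Q≡1; when s = N there is nothing to match as Q s 0 = 0.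
      leave-leaf-shifted : ∀ {s j w} → w < Q s j → 0 < s → s + j ≤ N → w ≡ 1 % suc N → StarOption s (j + suc N) w
      leave-leaf-shifted {s} {suc j} _ 0<s s+j≤N w≡ =
        leave-path (suc (suc N)) z<s (s≤s (m≤n+m (suc N) j))
          (subst (_< N + suc (suc N)) (+-assoc s (suc j) (suc N)) (+-mono-≤-< s+j≤N (n<1+n (suc N))))
          (trans w≡ (sym ([m+n]%n≡m%n 1 (suc N))))
      leave-leaf-shifted {s} {zero} {w} w<Q 0<s s+0≤N w≡ with m≤n⇒m<n∨m≡n (subst (_≤ N) (+-identityʳ s) s+0≤N)
      ... | inj₂ s≡N = contradiction (subst (w <_) (Q≡0 s 0 (trans (+-identityʳ s) s≡N)) w<Q) λ ()
      ... | inj₁ s<N = take-tail s 0<s (<⇒≤ s<N) s≤1+N (trans w≡ (trans 1%[1+N]≡1 (sym (Q≡1 s (suc N ∸ s) 0<s 2≤1+N∸s (m+[n∸m]≡n s≤1+N)))))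
        where
        s≤1+N = ≤-trans (<⇒≤ s<N) (n≤1+n N)
        2≤1+N∸s : 2 ≤ suc N ∸ s
        2≤1+N∸s = subst (2 ≤_) (sym (+-∸-assoc 1 (<⇒≤ s<N))) (s≤s (m<n⇒0<n∸m s<N))

      module Shift {s j : ℕ} (leaf-ih : OneLeafFewer (λ s j → Q s (j + suc N) ≡ Q s j) s)
                   (tail-ih : ∀ {y} → y < j → Q s (y + suc N) ≡ Q s y) where

        unshift-< : ∀ {m} → s + (j + suc N) < N + m → suc (s + j) < m
        unshift-< {m} h = +-cancelˡ-< N _ _ (subst (_< N + m) (shifted≡ s j) h)

        Q∉shifted : ¬ StarOption s (j + suc N) (Q s j)
        Q∉shifted (take-all s+j+T<N _) =
          <⇒≱ s+j+T<N (≤-trans (n≤1+n N) (≤-trans (m≤n+m (suc N) j) (m≤n+m (j + suc N) s)))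
        Q∉shifted (take-leaf s′ s≡ Q≡) = Q≢option (take-leaf s′ s≡ refl) (trans Q≡ (leaf-ih s≡ j))
        Q∉shifted (take-tail zero () _ _ _)
        Q∉shifted (take-tail (suc i) _ 1+i≤N _ Q≡) =
          Q≢option (take-tail d (m<n⇒0<n∸m 1+i≤N) (m∸n≤m N i) (m≤n+m d j) (cong (Q s) (sym (m+n∸n≡m j d))))
                   (sym (trans Q≡ (cong (Q s) (+-∸-assoc j (≤-trans 1+i≤N (n≤1+n N))))))
          where d = N ∸ i
        Q∉shifted (leave-path m 0<m m≤j+T h Q≡m%) with <-cmp m (suc N)
        ... | tri< m<T _ _ = <-irrefl (trans Q≡m% (m<n⇒m%n≡m m<T))
                                       (≤-<-trans (Q≤1+s+j s j) (unshift-< h))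
        ... | tri≈ _ refl _ = Q≢option (take-all (≤-pred (unshift-< h)) refl)
                                       (trans Q≡m% (n%n≡0 (suc N)))
        ... | tri> _ _ T<m = Q≢option (leave-path m′ (m<n⇒0<n∸m T<m) m′≤j h′ refl)
                                      (trans Q≡m% (trans (cong (_% suc N) (sym m′+T≡m)) ([m+n]%n≡m%n m′ (suc N))))
          where
          m′ = m ∸ suc N
          m′+T≡m : m′ + suc N ≡ m
          m′+T≡m = m∸n+n≡m (<⇒≤ T<m)
          m′≤j : m′ ≤ j
          m′≤j = +-cancelʳ-≤ (suc N) m′ j (subst (_≤ j + suc N) (sym m′+T≡m) m≤j+T)
          h′ : s + j < N + m′
          h′ = subst (s + j <_) (+-comm m′ N) (≤-pred (subst (suc (s + j) <_) (trans (sym m′+T≡m) (+-suc m′ N))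
                 (unshift-< h)))
        Q∉shifted (leave-leaf _ s+j+T≤N _) = 1+n≰n (≤-trans (≤-trans (m≤n+m (suc N) j) (m≤n+m (j + suc N) s)) s+j+T≤N)

        option-shifted : ∀ {w} → w < Q s j → StarOption s j w → StarOption s (j + suc N) w
        option-shifted _ (take-all s+j<N w≡0) =
          leave-path (suc N) z<s (m≤n+m (suc N) j) (subst (_< N + suc N) (sym (shifted≡ s j)) (+-monoʳ-< N (s≤s s+j<N)))
                     (trans w≡0 (sym (n%n≡0 (suc N))))
        option-shifted _ (take-leaf s′ s≡ w≡) = take-leaf s′ s≡ (trans w≡ (sym (leaf-ih s≡ j)))
        option-shifted _ (take-tail i 0<i i≤N i≤j w≡) = take-tail i 0<i i≤N (≤-trans i≤j (m≤m+n j (suc N)))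
          (trans w≡ (sym (trans (cong (Q s) (+-∸-comm (suc N) i≤j)) (tail-ih (j∸i<j 0<i i≤j)))))
        option-shifted _ (leave-path m 0<m m≤j s+j<N+m w≡) =
          leave-path (m + suc N) (≤-trans 0<m (m≤m+n m (suc N))) (+-monoˡ-≤ (suc N) m≤j)
                     (subst₂ _<_ (+-assoc s j (suc N)) (+-assoc N m (suc N)) (+-monoˡ-< (suc N) s+j<N+m))
                     (trans w≡ (sym ([m+n]%n≡m%n m (suc N))))
        option-shifted w<Q (leave-leaf 0<s s+j≤N w≡) = leave-leaf-shifted w<Q 0<s s+j≤N w≡

      Q-periodic : ∀ s j → Q s (j + suc N) ≡ Q s j
      Q-periodic = leaf-induction _ λ s leaf-ih → <-rec _ λ j tail-ih →
        let open Shift leaf-ih tail-ih in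
        IsMex-unique (Q-IsMex s (j + suc N)) (Q∉shifted , λ w w<Q → option-shifted w<Q (<Q⇒option w w<Q))

      Q-mod : ∀ s k → Q s k ≡ Q s (k % suc N)
      Q-mod s k = trans (cong (Q s) (m≡m%n+[m/n]*n k (suc N))) (shift-by-multiple (k % suc N) (k / suc N))
        where
        shift-by-multiple : ∀ r q → Q s (r + q * suc N) ≡ Q s r
        shift-by-multiple r zero    = cong (Q s) (+-identityʳ r)
        shift-by-multiple r (suc q) = begin
          Q s (r + (suc N + q * suc N)) ≡⟨ cong (Q s) (+-comm-middle r (suc N) (q * suc N)) ⟩
          Q s (r + q * suc N + suc N)   ≡⟨ Q-periodic s (r + q * suc N) ⟩
          Q s (r + q * suc N)           ≡⟨ shift-by-multiple r q ⟩
          Q s r                         ∎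
          where
          open ≡-Reasoning
          +-comm-middle : ∀ a b c → a + (b + c) ≡ a + c + b
          +-comm-middle = solve-∀

  module PathRecurrence (N : ℕ) where

    data PathOption (m w : ℕ) : Set where
      take-all : m ≤ N → w ≡ 0 → PathOption m w
      take-end : ∀ i → 0 < i → i ≤ N → i < m → w ≡ (m ∸ i) % suc N → PathOption m w

    [x+i]%≢x% : ∀ x i → 0 < i → i ≤ N → (x + i) % suc N ≢ x % suc N
    [x+i]%≢x% x i 0<i i≤N [x+i]%≡x% = reduced-shift-absurd (x % suc N) (m%n<n x (suc N)) (begin
      (x % suc N + i) % suc N          ≡⟨ cong (λ i′ → (x % suc N + i′) % suc N) (m<n⇒m%n≡m (s≤s i≤N)) ⟨
      (x % suc N + i % suc N) % suc N  ≡⟨ %-distribˡ-+ x i (suc N) ⟨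
      (x + i) % suc N                  ≡⟨ [x+i]%≡x% ⟩
      x % suc N                        ∎)
      where
      open ≡-Reasoning
      reduced-shift-absurd : ∀ r → r < suc N → (r + i) % suc N ≢ r
      reduced-shift-absurd r r<T r+i%≡r with r + i <? suc N
      ... | yes r+i<T = <-irrefl (trans (sym r+i%≡r) (m<n⇒m%n≡m r+i<T)) (m<m+n r 0<i)
      ... | no r+i≮T = <-irrefl i≡T (s≤s i≤N)
        where
        T≤r+i = ≮⇒≥ r+i≮T
        r+i∸T<T : r + i ∸ suc N < suc N
        r+i∸T<T = +-cancelʳ-< (suc N) _ _ (subst (_< suc N + suc N) (sym (m∸n+n≡m T≤r+i)) (+-mono-< r<T (s≤s i≤N)))
        r+i∸T≡r : r + i ∸ suc N ≡ r
        r+i∸T≡r = begin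
          r + i ∸ suc N            ≡⟨ m<n⇒m%n≡m r+i∸T<T ⟨
          (r + i ∸ suc N) % suc N  ≡⟨ m≤n⇒[n∸m]%m≡n%m T≤r+i ⟩
          (r + i) % suc N          ≡⟨ r+i%≡r ⟩
          r                        ∎
        i≡T : i ≡ suc N
        i≡T = +-cancelˡ-≡ r i (suc N) (trans (sym (m∸n+n≡m T≤r+i)) (cong (_+ suc N) r+i∸T≡r))

    path-IsMex : ∀ m → 0 < m → IsMex (PathOption m) (m % suc N)
    path-IsMex m 0<m = m%∉ , below-m%
      where
      m%∉ : ¬ PathOption m (m % suc N)
      m%∉ (take-all m≤N m%≡0) = <⇒≢ 0<m (sym (trans (sym (m≤n⇒m%n≡m m≤N)) m%≡0))
      m%∉ (take-end i 0<i i≤N i<m m%≡) =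
        [x+i]%≢x% (m ∸ i) i 0<i i≤N (trans (cong (_% suc N) (m∸n+n≡m (<⇒≤ i<m))) m%≡)

      r = m % suc N

      below-m% : ∀ w → w < r → PathOption m w
      below-m% w w<r with r ∸ w <? m
      ... | yes r∸w<m = take-end (r ∸ w) (m<n⇒0<n∸m w<r) (≤-trans (m∸n≤m r w) (≤-pred (m%n<n m (suc N)))) r∸w<m (sym (begin
        (m ∸ (r ∸ w)) % suc N              ≡⟨ cong (_% suc N) m∸[r∸w]≡w+[m∸r] ⟩
        (w + (m ∸ r)) % suc N              ≡⟨ cong (λ x → (w + x) % suc N) m∸r≡[m/T]*T ⟩
        (w + (m / suc N) * suc N) % suc N  ≡⟨ [m+kn]%n≡m%n w (m / suc N) (suc N) ⟩
        w % suc N                          ≡⟨ m<n⇒m%n≡m (<-trans w<r (m%n<n m (suc N))) ⟩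
        w                                  ∎))
        where
        open ≡-Reasoning
        r≤m = m%n≤m m (suc N)
        m∸[r∸w]≡w+[m∸r] : m ∸ (r ∸ w) ≡ w + (m ∸ r)
        m∸[r∸w]≡w+[m∸r] = begin
          m ∸ (r ∸ w)              ≡⟨ cong (_∸ (r ∸ w)) (m∸n+n≡m r≤m) ⟨
          (m ∸ r) + r ∸ (r ∸ w)    ≡⟨ +-∸-assoc (m ∸ r) (m∸n≤m r w) ⟩
          (m ∸ r) + (r ∸ (r ∸ w))  ≡⟨ cong ((m ∸ r) +_) (m∸[m∸n]≡n (<⇒≤ w<r)) ⟩
          (m ∸ r) + w              ≡⟨ +-comm (m ∸ r) w ⟩
          w + (m ∸ r)              ∎
        m∸r≡[m/T]*T : m ∸ r ≡ (m / suc N) * suc N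
        m∸r≡[m/T]*T = trans (cong (_∸ r) (m≡m%n+[m/n]*n m (suc N))) (m+n∸m≡n r _)
      ... | no r∸w≮m = take-all m≤N (n≤0⇒n≡0 (≮⇒≥ λ 0<w → <⇒≱ (j∸i<j 0<w (<⇒≤ w<r)) r≤r∸w))
        where
        r≡m : r ≡ m
        r≡m = ≤-antisym (m%n≤m m (suc N)) (≤-trans (≮⇒≥ r∸w≮m) (m∸n≤m r w))
        m≤N : m ≤ N
        m≤N = ≤-pred (subst (_< suc N) r≡m (m%n<n m (suc N)))
        r≤r∸w : r ≤ r ∸ w
        r≤r∸w = subst (_≤ r ∸ w) (sym r≡m) (≮⇒≥ r∸w≮m)

module Booleans where

  open import Data.Bool using (Bool; true; false; _∧_; _∨_; not; T)
  open import Data.Bool.Properties using (T-≡; ∧-zeroʳ)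
  open import Data.Nat
  open import Data.Nat.Properties
  open import Data.Product using (_×_; _,_)
  open import Data.Sum using (_⊎_; inj₁; inj₂)
  open import Data.Unit using (tt)
  open import Function using (_∘_; Equivalence)
  open import Relation.Nullary using (¬_; yes; no; contradiction)
  open import Relation.Binary.PropositionalEquality

  ¬T⇒≡false : ∀ {b} → ¬ T b → b ≡ false
  ¬T⇒≡false {false} _ = refl
  ¬T⇒≡false {true} ¬T = contradiction tt ¬T

  ≡true⇒≢false : ∀ {b} → b ≡ true → b ≢ false
  ≡true⇒≢false refl ()

  ∧≡true⁻ : ∀ {a b} → (a ∧ b) ≡ true → a ≡ true × b ≡ true
  ∧≡true⁻ {true} {true} _ = refl , refl

  ∧≡true⁺ : ∀ {a b} → a ≡ true → b ≡ true → (a ∧ b) ≡ true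
  ∧≡true⁺ refl refl = refl

  ∨≡true⁻ : ∀ {a b} → (a ∨ b) ≡ true → a ≡ true ⊎ b ≡ true
  ∨≡true⁻ {true} _ = inj₁ refl
  ∨≡true⁻ {false} b≡true = inj₂ b≡true

  not≡true⁻ : ∀ {a} → not a ≡ true → a ≡ false
  not≡true⁻ {false} _ = refl

  ≤⇒≤ᵇ≡true : ∀ {m n} → m ≤ n → (m ≤ᵇ n) ≡ true
  ≤⇒≤ᵇ≡true = Equivalence.to T-≡ ∘ ≤⇒≤ᵇ

  ≤ᵇ≡true⇒≤ : ∀ {m n} → (m ≤ᵇ n) ≡ true → m ≤ n
  ≤ᵇ≡true⇒≤ {m} {n} = ≤ᵇ⇒≤ m n ∘ Equivalence.from T-≡

  >⇒≤ᵇ≡false : ∀ {m n} → n < m → (m ≤ᵇ n) ≡ false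
  >⇒≤ᵇ≡false {m} {n} n<m = ¬T⇒≡false (<⇒≱ n<m ∘ ≤ᵇ⇒≤ m n)

  <⇒<ᵇ≡true : ∀ {m n} → m < n → (m <ᵇ n) ≡ true
  <⇒<ᵇ≡true = Equivalence.to T-≡ ∘ <⇒<ᵇ

  <ᵇ≡true⇒< : ∀ {m n} → (m <ᵇ n) ≡ true → m < n
  <ᵇ≡true⇒< {m} {n} = <ᵇ⇒< m n ∘ Equivalence.from T-≡

  ≥⇒<ᵇ≡false : ∀ {m n} → n ≤ m → (m <ᵇ n) ≡ false
  ≥⇒<ᵇ≡false {m} {n} n≤m = ¬T⇒≡false (≤⇒≯ n≤m ∘ <ᵇ⇒< m n)

  ≡⇒≡ᵇ≡true : ∀ {m n} → m ≡ n → (m ≡ᵇ n) ≡ true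
  ≡⇒≡ᵇ≡true {m} {n} = Equivalence.to T-≡ ∘ ≡⇒≡ᵇ m n

  ≡ᵇ≡true⇒≡ : ∀ {m n} → (m ≡ᵇ n) ≡ true → m ≡ n
  ≡ᵇ≡true⇒≡ {m} {n} = ≡ᵇ⇒≡ m n ∘ Equivalence.from T-≡

  intervalᵇ : ℕ → ℕ → ℕ → Bool
  intervalᵇ a m i = (a ≤ᵇ i) ∧ (i <ᵇ a + m)

  intervalᵇ≡true : ∀ {a m i} → a ≤ i → i < a + m → intervalᵇ a m i ≡ true
  intervalᵇ≡true a≤i i<a+m = ∧≡true⁺ (≤⇒≤ᵇ≡true a≤i) (<⇒<ᵇ≡true i<a+m)

  intervalᵇ≡true⇒ : ∀ {a m i} → intervalᵇ a m i ≡ true → a ≤ i × i < a + m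
  intervalᵇ≡true⇒ i∈ = let (a≤i , i<a+m) = ∧≡true⁻ i∈ in ≤ᵇ≡true⇒≤ a≤i , <ᵇ≡true⇒< i<a+m

  <⇒intervalᵇ≡false : ∀ {a m i} → i < a → intervalᵇ a m i ≡ false
  <⇒intervalᵇ≡false {a} {m} {i} i<a rewrite >⇒≤ᵇ≡false {a} {i} i<a = refl

  ≥⇒intervalᵇ≡false : ∀ {a m i} → a + m ≤ i → intervalᵇ a m i ≡ false
  ≥⇒intervalᵇ≡false {a} {m} {i} a+m≤i rewrite ≥⇒<ᵇ≡false {i} {a + m} a+m≤i = ∧-zeroʳ (a ≤ᵇ i)

  <ᵇ-∧-not-intervalᵇ : ∀ a m p → ((p <ᵇ a + m) ∧ not (intervalᵇ a m p)) ≡ (p <ᵇ a)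
  <ᵇ-∧-not-intervalᵇ a m p with p <? a | p <? a + m
  ... | yes p<a | _ rewrite <⇒<ᵇ≡true (≤-trans p<a (m≤m+n a m)) | >⇒≤ᵇ≡false p<a | <⇒<ᵇ≡true p<a = refl
  ... | no p≮a | yes p<a+m rewrite <⇒<ᵇ≡true p<a+m | ≤⇒≤ᵇ≡true (≮⇒≥ p≮a) | ≥⇒<ᵇ≡false (≮⇒≥ p≮a) = refl
  ... | no p≮a | no p≮a+m rewrite ≥⇒<ᵇ≡false (≮⇒≥ p≮a+m) | ≥⇒<ᵇ≡false (≮⇒≥ p≮a) = refl

module Subsets where

  open Booleans
  open import Data.Bool using (Bool; true; false; _∧_; not; if_then_else_)
  open import Data.Bool.Properties using (∧-zeroʳ; ∧-identityʳ)
  open import Data.Nat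
  open import Data.Nat.Properties
  open import Data.Fin using (Fin; toℕ; fromℕ<; zero; suc)
  open import Data.Fin.Properties using (toℕ-fromℕ<)
  open import Data.Fin.Subset using (Subset; inside; outside; _─_; ∣_∣)
  open import Data.List using (List; []; _∷_; concatMap)
  open import Data.List.Membership.Propositional using (_∈_)
  open import Data.List.Membership.Propositional.Properties using (∈-map⁺; ∈-map⁻)
  open import Data.List.Relation.Unary.Any using (here; there)
  open import Data.Vec using ([]; _∷_; tabulate; lookup; replicate)
  open import Data.Vec.Properties using (lookup∘tabulate)
  open import Data.Product using (∃; _×_; _,_; proj₁)
  open import Data.Sum using (_⊎_; inj₁; inj₂)
  open import Function using (_∘_)
  open import Relation.Nullary using (yes; no; contradiction)
  open import Relation.Binary.PropositionalEquality

  mem : ∀ {n} → Subset n → ℕ → Bool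
  mem [] _ = false
  mem (b ∷ v) zero = b
  mem (b ∷ v) (suc i) = mem v i

  _⊆ₘ_ : ∀ {n} → Subset n → Subset n → Set
  X ⊆ₘ Y = ∀ i → mem X i ≡ true → mem Y i ≡ true

  Empty : ∀ {n} → Subset n → Set
  Empty X = ∀ i → mem X i ≡ false

  mem-lookup : ∀ {n} (v : Subset n) (i : Fin n) → mem v (toℕ i) ≡ lookup v i
  mem-lookup (b ∷ v) zero = refl
  mem-lookup (b ∷ v) (suc i) = mem-lookup v i

  mem-fromℕ< : ∀ {n} (v : Subset n) {i} (i<n : i < n) → lookup v (fromℕ< i<n) ≡ mem v i
  mem-fromℕ< v i<n = trans (sym (mem-lookup v (fromℕ< i<n))) (cong (mem v) (toℕ-fromℕ< i<n))

  mem-≥ : ∀ {n} (v : Subset n) i → n ≤ i → mem v i ≡ false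
  mem-≥ [] i _ = refl
  mem-≥ (b ∷ v) (suc i) (s≤s n≤i) = mem-≥ v i n≤i

  mem⇒< : ∀ {n} (v : Subset n) i → mem v i ≡ true → i < n
  mem⇒< {n} v i i∈ with i <? n
  ... | yes i<n = i<n
  ... | no i≮n = contradiction (mem-≥ v i (≮⇒≥ i≮n)) (≡true⇒≢false i∈)

  mem-─ : ∀ {n} (Y X : Subset n) i → mem (Y ─ X) i ≡ (mem Y i ∧ not (mem X i))
  mem-─ [] [] i = refl
  mem-─ (a ∷ Y) (true ∷ X) zero = sym (∧-zeroʳ a)
  mem-─ (a ∷ Y) (false ∷ X) zero = sym (∧-identityʳ a)
  mem-─ (a ∷ Y) (b ∷ X) (suc i) = mem-─ Y X i

  mem-tabulate : ∀ {n} (f : Fin n → Bool) {i} (i<n : i < n) → mem (tabulate f) i ≡ f (fromℕ< i<n)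
  mem-tabulate f i<n = trans (sym (mem-fromℕ< (tabulate f) i<n)) (lookup∘tabulate f (fromℕ< i<n))

  mem-outside : ∀ n i → mem (replicate n outside) i ≡ false
  mem-outside zero i = refl
  mem-outside (suc n) zero = refl
  mem-outside (suc n) (suc i) = mem-outside n i

  mem-inside : ∀ n i → mem (replicate n inside) i ≡ (i <ᵇ n)
  mem-inside zero i = refl
  mem-inside (suc n) zero = refl
  mem-inside (suc n) (suc i) = mem-inside n i

  fromPred : ∀ n → (ℕ → Bool) → Subset n
  fromPred zero φ = []
  fromPred (suc n) φ = φ 0 ∷ fromPred n (φ ∘ suc)

  mem-fromPred : ∀ n φ → (∀ i → n ≤ i → φ i ≡ false) → ∀ i → mem (fromPred n φ) i ≡ φ i
  mem-fromPred zero φ φ≥n≡false i = sym (φ≥n≡false i z≤n)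
  mem-fromPred (suc n) φ φ≥n≡false zero = refl
  mem-fromPred (suc n) φ φ≥n≡false (suc i) = mem-fromPred n (φ ∘ suc) (λ i n≤i → φ≥n≡false (suc i) (s≤s n≤i)) i

  empty⊎member : ∀ {n} (X : Subset n) → Empty X ⊎ ∃ λ x → mem X x ≡ true
  empty⊎member [] = inj₁ λ _ → refl
  empty⊎member (true ∷ X) = inj₂ (0 , refl)
  empty⊎member (false ∷ X) with empty⊎member X
  ... | inj₁ empty = inj₁ λ { zero → refl ; (suc i) → empty i }
  ... | inj₂ (x , x∈) = inj₂ (suc x , x∈)

  least-member : ∀ {n} (X : Subset n) x → mem X x ≡ true →
                 ∃ λ lo → mem X lo ≡ true × (∀ y → mem X y ≡ true → lo ≤ y)
  least-member (true ∷ X) _ _ = 0 , refl , λ _ _ → z≤n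
  least-member (false ∷ X) (suc x) x∈ with least-member X x x∈
  ... | lo , lo∈ , least = suc lo , lo∈ , λ { (suc y) y∈ → s≤s (least y y∈) }

  greatest-member : ∀ {n} (X : Subset n) x → mem X x ≡ true →
                    ∃ λ hi → mem X hi ≡ true × (∀ y → mem X y ≡ true → y ≤ hi)
  greatest-member (b ∷ X) x x∈ with empty⊎member X
  greatest-member (b ∷ X) zero x∈ | inj₁ empty =
    0 , x∈ , λ { zero _ → z≤n ; (suc y) y∈ → contradiction (empty y) (≡true⇒≢false y∈) }
  greatest-member (b ∷ X) (suc x) x∈ | inj₁ empty = contradiction (empty x) (≡true⇒≢false x∈)
  greatest-member (b ∷ X) x x∈ | inj₂ (y , y∈) with greatest-member X y y∈
  ... | hi , hi∈ , greatest = suc hi , hi∈ , λ { zero _ → z≤n ; (suc y) y∈ → s≤s (greatest y y∈) }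

  private
    both-sides : ∀ {n} → List (Subset n) → List (Subset (suc n))
    both-sides = concatMap (λ x → (inside ∷ x) ∷ (outside ∷ x) ∷ [])

    ∈-both-sides⁺ : ∀ {n} {x : Subset n} {xs} b → x ∈ xs → (b ∷ x) ∈ both-sides xs
    ∈-both-sides⁺ true (here refl) = here refl
    ∈-both-sides⁺ false (here refl) = there (here refl)
    ∈-both-sides⁺ b (there x∈) = there (there (∈-both-sides⁺ b x∈))

    ∈-both-sides⁻ : ∀ {n} {x : Subset n} {xs} b → (b ∷ x) ∈ both-sides xs → x ∈ xs
    ∈-both-sides⁻ {xs = _ ∷ _} b (here refl) = here refl
    ∈-both-sides⁻ {xs = _ ∷ _} b (there (here refl)) = here refl
    ∈-both-sides⁻ {xs = _ ∷ _} b (there (there b∷x∈)) = there (∈-both-sides⁻ b b∷x∈)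

  ∈-subsetsOf⁺ : ∀ {n} (Y X : Subset n) → X ⊆ₘ Y → X ∈ subsetsOf Y
  ∈-subsetsOf⁺ [] [] _ = here refl
  ∈-subsetsOf⁺ (true ∷ Y) (b ∷ X) X⊆Y = ∈-both-sides⁺ b (∈-subsetsOf⁺ Y X (X⊆Y ∘ suc))
  ∈-subsetsOf⁺ (false ∷ Y) (true ∷ X) X⊆Y = contradiction (X⊆Y 0 refl) λ ()
  ∈-subsetsOf⁺ (false ∷ Y) (false ∷ X) X⊆Y = ∈-map⁺ (false ∷_) (∈-subsetsOf⁺ Y X (X⊆Y ∘ suc))

  ∈-subsetsOf⁻ : ∀ {n} (Y X : Subset n) → X ∈ subsetsOf Y → X ⊆ₘ Y
  ∈-subsetsOf⁻ (true ∷ Y) (b ∷ X) _ zero _ = refl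
  ∈-subsetsOf⁻ (true ∷ Y) (b ∷ X) X∈ (suc i) = ∈-subsetsOf⁻ Y X (∈-both-sides⁻ b X∈) i
  ∈-subsetsOf⁻ (false ∷ Y) (b ∷ X) X∈ i with ∈-map⁻ (false ∷_) X∈
  ∈-subsetsOf⁻ (false ∷ Y) (false ∷ X) X∈ (suc i) | X , X∈′ , refl = ∈-subsetsOf⁻ Y X X∈′ i

  mem-firstElem⁻ : ∀ {n} (X : Subset n) i → mem (firstElem X) i ≡ true →
                   mem X i ≡ true × (∀ y → mem X y ≡ true → i ≤ y)
  mem-firstElem⁻ (true ∷ X) zero _ = refl , λ _ _ → z≤n
  mem-firstElem⁻ {suc n} (true ∷ X) (suc i) i∈ = contradiction (mem-outside n i) (≡true⇒≢false i∈)
  mem-firstElem⁻ (false ∷ X) (suc i) i∈ with mem-firstElem⁻ X i i∈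
  ... | i∈X , least = i∈X , λ { (suc y) y∈ → s≤s (least y y∈) }

  mem-firstElem⁺ : ∀ {n} (X : Subset n) i → mem X i ≡ true → (∀ y → y < i → mem X y ≡ false) →
                   mem (firstElem X) i ≡ true
  mem-firstElem⁺ (true ∷ X) zero _ _ = refl
  mem-firstElem⁺ (true ∷ X) (suc i) _ below∉ = contradiction (below∉ 0 z<s) λ ()
  mem-firstElem⁺ (false ∷ X) (suc i) i∈ below∉ = mem-firstElem⁺ X i i∈ (λ y y<i → below∉ (suc y) (s≤s y<i))

  isEmptyᵇ≡true⁺ : ∀ {n} (X : Subset n) → Empty X → isEmptyᵇ X ≡ true
  isEmptyᵇ≡true⁺ [] _ = refl
  isEmptyᵇ≡true⁺ (b ∷ X) empty rewrite empty 0 = isEmptyᵇ≡true⁺ X (empty ∘ suc)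

  isEmptyᵇ≡true⁻ : ∀ {n} (X : Subset n) → isEmptyᵇ X ≡ true → Empty X
  isEmptyᵇ≡true⁻ [] _ i = refl
  isEmptyᵇ≡true⁻ (false ∷ X) _ zero = refl
  isEmptyᵇ≡true⁻ (false ∷ X) X-empty (suc i) = isEmptyᵇ≡true⁻ X X-empty i

  eqSubᵇ≡true⁺ : ∀ {n} (A B : Subset n) → (∀ i → mem A i ≡ mem B i) → eqSubᵇ A B ≡ true
  eqSubᵇ≡true⁺ [] [] _ = refl
  eqSubᵇ≡true⁺ (a ∷ A) (b ∷ B) same with a | b | same 0
  ... | true | true | _ = eqSubᵇ≡true⁺ A B (same ∘ suc)
  ... | false | false | _ = eqSubᵇ≡true⁺ A B (same ∘ suc)

  eqSubᵇ≡true⁻ : ∀ {n} (A B : Subset n) → eqSubᵇ A B ≡ true → ∀ i → mem A i ≡ mem B i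
  eqSubᵇ≡true⁻ [] [] _ _ = refl
  eqSubᵇ≡true⁻ (true ∷ A) (true ∷ B) _ zero = refl
  eqSubᵇ≡true⁻ (false ∷ A) (false ∷ B) _ zero = refl
  eqSubᵇ≡true⁻ (true ∷ A) (true ∷ B) A≡B (suc i) = eqSubᵇ≡true⁻ A B A≡B i
  eqSubᵇ≡true⁻ (false ∷ A) (false ∷ B) A≡B (suc i) = eqSubᵇ≡true⁻ A B A≡B i

  count : (ℕ → Bool) → ℕ → ℕ
  count φ zero = 0
  count φ (suc n) = if φ 0 then suc (count (φ ∘ suc) n) else count (φ ∘ suc) n

  ∣∣≡count : ∀ {n} (X : Subset n) → ∣ X ∣ ≡ count (mem X) n
  ∣∣≡count [] = refl
  ∣∣≡count (true ∷ X) = cong suc (∣∣≡count X)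
  ∣∣≡count (false ∷ X) = ∣∣≡count X

  count-true : ∀ n φ → φ 0 ≡ true → count φ (suc n) ≡ suc (count (φ ∘ suc) n)
  count-true n φ φ0 rewrite φ0 = refl

  count-cong : ∀ n {φ ψ} → (∀ i → i < n → φ i ≡ ψ i) → count φ n ≡ count ψ n
  count-cong zero _ = refl
  count-cong (suc n) {φ} {ψ} φ≡ψ rewrite φ≡ψ 0 z<s with ψ 0
  ... | true = cong suc (count-cong n λ i i<n → φ≡ψ (suc i) (s≤s i<n))
  ... | false = count-cong n λ i i<n → φ≡ψ (suc i) (s≤s i<n)

  count-false : ∀ n φ → (∀ i → φ i ≡ false) → count φ n ≡ 0
  count-false zero φ _ = refl
  count-false (suc n) φ φ≡false rewrite φ≡false 0 = count-false n (φ ∘ suc) (φ≡false ∘ suc)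

  count-+ : ∀ a b φ → count φ (a + b) ≡ count φ a + count (φ ∘ (a +_)) b
  count-+ zero b φ = refl
  count-+ (suc a) b φ with φ 0
  ... | true = cong suc (count-+ a b (φ ∘ suc))
  ... | false = count-+ a b (φ ∘ suc)

  +-cancelˡ-<ᵇ : ∀ a {i j} → (a + i <ᵇ a + j) ≡ (i <ᵇ j)
  +-cancelˡ-<ᵇ zero = refl
  +-cancelˡ-<ᵇ (suc a) = +-cancelˡ-<ᵇ a

  count-<ᵇ : ∀ {j k} → j ≤ k → count (_<ᵇ j) k ≡ j
  count-<ᵇ {zero} {k} _ = count-false k _ λ { zero → refl ; (suc i) → refl }
  count-<ᵇ {suc j} (s≤s j≤k) = cong suc (count-<ᵇ j≤k)

  count-intervalᵇ : ∀ n a m → a + m ≤ n → count (intervalᵇ a m) n ≡ m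
  count-intervalᵇ n zero m m≤n = count-<ᵇ m≤n
  count-intervalᵇ (suc n) (suc a) m (s≤s a+m≤n) =
    trans (count-cong n λ i _ → cong (_∧ (i <ᵇ a + m)) (<ᵇ-suc a i)) (count-intervalᵇ n a m a+m≤n)
    where
    <ᵇ-suc : ∀ a i → (a <ᵇ suc i) ≡ (a ≤ᵇ i)
    <ᵇ-suc zero i = refl
    <ᵇ-suc (suc a) i = refl

  count>0⇒witness : ∀ n φ → 0 < count φ n → ∃ λ i → i < n × φ i ≡ true
  count>0⇒witness (suc n) φ 0<count with φ 0 in φ0
  ... | true = 0 , z<s , φ0
  ... | false with count>0⇒witness n (φ ∘ suc) 0<count
  ... | i , i<n , φi = suc i , s≤s i<n , φi

  witness⇒count>0 : ∀ n φ i → i < n → φ i ≡ true → 0 < count φ n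
  witness⇒count>0 (suc n) φ zero _ φ0 rewrite φ0 = z<s
  witness⇒count>0 (suc n) φ (suc i) (s≤s i<n) φi with φ 0
  ... | true = z<s
  ... | false = witness⇒count>0 n (φ ∘ suc) i i<n φi

  Empty⇒∣∣≡0 : ∀ {n} (X : Subset n) → Empty X → ∣ X ∣ ≡ 0
  Empty⇒∣∣≡0 {n} X empty = trans (∣∣≡count X) (count-false n (mem X) empty)

  ∣─∣+∣∣≡∣∣ : ∀ {n} (Y X : Subset n) → X ⊆ₘ Y → ∣ Y ─ X ∣ + ∣ X ∣ ≡ ∣ Y ∣
  ∣─∣+∣∣≡∣∣ [] [] _ = refl
  ∣─∣+∣∣≡∣∣ (a ∷ Y) (true ∷ X) X⊆Y rewrite X⊆Y 0 refl =
    trans (+-suc ∣ Y ─ X ∣ ∣ X ∣) (cong suc (∣─∣+∣∣≡∣∣ Y X (X⊆Y ∘ suc)))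
  ∣─∣+∣∣≡∣∣ (true ∷ Y) (false ∷ X) X⊆Y = cong suc (∣─∣+∣∣≡∣∣ Y X (X⊆Y ∘ suc))
  ∣─∣+∣∣≡∣∣ (false ∷ Y) (false ∷ X) X⊆Y = ∣─∣+∣∣≡∣∣ Y X (X⊆Y ∘ suc)

  ─-⊆ : ∀ {n} (Y X : Subset n) → (Y ─ X) ⊆ₘ Y
  ─-⊆ Y X i i∈ = proj₁ (∧≡true⁻ (trans (sym (mem-─ Y X i)) i∈))

  mem-─-─ : ∀ {n} (Y R : Subset n) → R ⊆ₘ Y → ∀ i → mem (Y ─ (Y ─ R)) i ≡ mem R i
  mem-─-─ Y R R⊆Y i =
    trans (mem-─ Y (Y ─ R) i) (trans (cong (λ b → mem Y i ∧ not b) (mem-─ Y R i)) (lemma (mem Y i) (mem R i) (R⊆Y i)))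
    where
    lemma : ∀ y r → (r ≡ true → y ≡ true) → (y ∧ not (y ∧ not r)) ≡ r
    lemma true true _ = refl
    lemma true false _ = refl
    lemma false true r⇒y = r⇒y refl
    lemma false false _ = refl

module Game where

  open Mex
  open Booleans
  open Subsets
  open import Data.Bool using (Bool; true; false; _∧_; _∨_; not; T?)
  open import Data.Bool.Properties using (T-≡; ∨-zeroʳ; ¬-not)
  open import Data.Nat
  open import Data.Nat.Properties
  open import Data.Fin using (Fin; toℕ; fromℕ<)
  import Data.Fin as Fin
  open import Data.Fin.Properties using (toℕ-fromℕ<)
  open import Data.Fin.Subset using (Subset; _─_; ∣_∣)
  open import Data.List using (List; map)
  open import Data.Bool.ListAction using (any)
  open import Data.List.Membership.Propositional using (_∈_)
  open import Data.List.Membership.Propositional.Properties using (∈-map⁺; ∈-map⁻; ∈-filter⁺; ∈-filter⁻)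
  open import Data.List.Relation.Unary.Any as Any using (here; there)
  open import Data.List.Relation.Unary.Any.Properties using (any⁺; any⁻)
  open import Data.Vec using (tabulate; toList; lookup)
  open import Data.Product using (∃; _×_; _,_; proj₁)
  open import Data.Sum using (_⊎_; inj₁; inj₂)
  open import Function using (_∘_; _⇔_; mk⇔; Equivalence)
  open import Relation.Nullary using (¬_; contradiction)
  open import Relation.Binary.PropositionalEquality

  legalᵇ : ∀ {n} → (ℕ → Bool) → Graph n → Subset n → Subset n → Bool
  legalᵇ L G Y X = not (isEmptyᵇ X) ∧ L ∣ X ∣ ∧ connectedᵇ G X ∧ connectedᵇ G (Y ─ X)

  ∈-options⁻ : ∀ {n} (g : Subset n → ℕ) L G Y {w} → w ∈ map g (options L G Y) →
               ∃ λ X → X ⊆ₘ Y × legalᵇ L G Y X ≡ true × w ≡ g (Y ─ X)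
  ∈-options⁻ g L G Y w∈ with ∈-map⁻ g w∈
  ... | _ , Y─X∈ , refl with ∈-map⁻ (Y ─_) Y─X∈
  ... | X , X∈ , refl with ∈-filter⁻ (T? ∘ legalᵇ L G Y) {xs = subsetsOf Y} X∈
  ... | X∈subsets , legal = X , ∈-subsetsOf⁻ Y X X∈subsets , Equivalence.to T-≡ legal , refl

  ∈-options⁺ : ∀ {n} (g : Subset n → ℕ) L G Y X → X ⊆ₘ Y → legalᵇ L G Y X ≡ true →
               g (Y ─ X) ∈ map g (options L G Y)
  ∈-options⁺ g L G Y X X⊆Y legal =
    ∈-map⁺ g (∈-map⁺ (Y ─_) (∈-filter⁺ (T? ∘ legalᵇ L G Y) (∈-subsetsOf⁺ Y X X⊆Y) (Equivalence.from T-≡ legal)))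

  grundyF-Empty : ∀ {n} fuel L (G : Graph n) Y → Empty Y → grundyF fuel L G Y ≡ 0
  grundyF-Empty zero L G Y _ = refl
  grundyF-Empty (suc fuel) L G Y empty = IsMex-unique (mex-IsMex _) (no-option , λ _ ())
    where
    no-option : ¬ 0 ∈ map (grundyF fuel L G) (options L G Y)
    no-option 0∈ with ∈-options⁻ (grundyF fuel L G) L G Y 0∈
    ... | X , X⊆Y , legal , _ =
      contradiction (not≡true⁻ (proj₁ (∧≡true⁻ legal))) (≡true⇒≢false (isEmptyᵇ≡true⁺ X X-empty))
      where
      X-empty : Empty X
      X-empty i = ¬-not λ i∈ → contradiction (empty i) (≡true⇒≢false (X⊆Y i i∈))

  record Move {n} (N : ℕ) (G : Graph n) (Y X : Subset n) : Set where
    field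
      X⊆Y : X ⊆ₘ Y
      0<∣X∣ : 0 < ∣ X ∣
      ∣X∣≤N : ∣ X ∣ ≤ N
      X-connected : connectedᵇ G X ≡ true
      rest-connected : connectedᵇ G (Y ─ X) ≡ true

  MoveValue : ∀ {n} → ℕ → Graph n → (Subset n → ℕ) → Subset n → ℕ → Set
  MoveValue N G g Y w = ∃ λ X → Move N G Y X × w ≡ g (Y ─ X)

  legalᵇ-I⇔Move : ∀ {n} N (G : Graph n) Y X → X ⊆ₘ Y → legalᵇ (I N) G Y X ≡ true ⇔ Move N G Y X
  legalᵇ-I⇔Move N G Y X X⊆Y = mk⇔ to from
    where
    to : legalᵇ (I N) G Y X ≡ true → Move N G Y X
    to legal =
      let (_ , size-connected) = ∧≡true⁻ {not (isEmptyᵇ X)} legal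
          (size , connected) = ∧≡true⁻ size-connected
          (1≤∣X∣ , ∣X∣≤N) = ∧≡true⁻ size
          (X-connected , rest-connected) = ∧≡true⁻ connected
      in record { X⊆Y = X⊆Y ; 0<∣X∣ = ≤ᵇ≡true⇒≤ 1≤∣X∣ ; ∣X∣≤N = ≤ᵇ≡true⇒≤ ∣X∣≤N
                ; X-connected = X-connected ; rest-connected = rest-connected }
    from : Move N G Y X → legalᵇ (I N) G Y X ≡ true
    from move = ∧≡true⁺ (cong not nonempty) (∧≡true⁺ (∧≡true⁺ (≤⇒≤ᵇ≡true 0<∣X∣) (≤⇒≤ᵇ≡true ∣X∣≤N))
                                                    (∧≡true⁺ X-connected rest-connected))
      where
      open Move move
      nonempty : isEmptyᵇ X ≡ false
      nonempty = ¬-not λ empty → <⇒≢ 0<∣X∣ (sym (Empty⇒∣∣≡0 X (isEmptyᵇ≡true⁻ X empty)))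

  grundyF-IsMex : ∀ {n} fuel N (G : Graph n) Y →
                  IsMex (MoveValue N G (grundyF fuel (I N) G) Y) (grundyF (suc fuel) (I N) G Y)
  grundyF-IsMex {n} fuel N G Y = IsMex-resp-⇔ (λ w → mk⇔ (to w) (from w)) (mex-IsMex _)
    where
    g : Subset n → ℕ
    g = grundyF fuel (I N) G
    to : ∀ w → w ∈ map g (options (I N) G Y) → MoveValue N G g Y w
    to w w∈ = let (X , X⊆Y , legal , w≡) = ∈-options⁻ g (I N) G Y w∈
              in X , Equivalence.to (legalᵇ-I⇔Move N G Y X X⊆Y) legal , w≡
    from : ∀ w → MoveValue N G g Y w → w ∈ map g (options (I N) G Y)
    from w (X , move , refl) =
      ∈-options⁺ g (I N) G Y X (Move.X⊆Y move) (Equivalence.from (legalᵇ-I⇔Move N G Y X (Move.X⊆Y move)) move)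

  module Connectivity (E : ℕ → ℕ → Bool) (n : ℕ) where

    G : Graph n
    G i j = E (toℕ i) (toℕ j)

    private
      vertices : List (Fin n)
      vertices = toList (tabulate (λ v → v))

      ∈-vertices : ∀ v → v ∈ vertices
      ∈-vertices = ∈-tabulate
        where
        ∈-tabulate : ∀ {m} {B : Set} {f : Fin m → B} v → f v ∈ toList (tabulate f)
        ∈-tabulate Fin.zero = here refl
        ∈-tabulate (Fin.suc v) = there (∈-tabulate v)

      adjacentᵇ : Subset n → ∀ {w} → w < n → Bool
      adjacentᵇ A w<n = any (λ v → lookup A v ∧ G v (fromℕ< w<n)) vertices

      mem-step : ∀ S A w (w<n : w < n) → mem (step G S A) w ≡ (mem A w ∨ (mem S w ∧ adjacentᵇ A w<n))
      mem-step S A w w<n =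
        trans (mem-tabulate _ w<n) (cong₂ (λ a b → a ∨ (b ∧ adjacentᵇ A w<n)) (mem-fromℕ< A w<n) (mem-fromℕ< S w<n))

    step-⊇ : ∀ S A w → mem A w ≡ true → mem (step G S A) w ≡ true
    step-⊇ S A w w∈A = trans (mem-step S A w w<n) (cong (_∨ (mem S w ∧ adjacentᵇ A w<n)) w∈A)
      where w<n = mem⇒< A w w∈A

    step-edge : ∀ S A v w → mem A v ≡ true → E v w ≡ true → mem S w ≡ true → mem (step G S A) w ≡ true
    step-edge S A v w v∈A vw w∈S = begin
      mem (step G S A) w                     ≡⟨ mem-step S A w w<n ⟩
      mem A w ∨ (mem S w ∧ adjacentᵇ A w<n)  ≡⟨ cong₂ (λ a b → mem A w ∨ (a ∧ b)) w∈S adjacent ⟩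
      mem A w ∨ true                         ≡⟨ ∨-zeroʳ (mem A w) ⟩
      true                                   ∎
      where
      open ≡-Reasoning
      w<n = mem⇒< S w w∈S
      v<n = mem⇒< A v v∈A
      edge-from-A : lookup A (fromℕ< v<n) ∧ G (fromℕ< v<n) (fromℕ< w<n) ≡ true
      edge-from-A = trans (cong₂ _∧_ (mem-fromℕ< A v<n) (cong₂ E (toℕ-fromℕ< v<n) (toℕ-fromℕ< w<n))) (cong₂ _∧_ v∈A vw)
      adjacent : adjacentᵇ A w<n ≡ true
      adjacent = Equivalence.to T-≡ (any⁺ _ (Any.map (λ { refl → Equivalence.from T-≡ edge-from-A }) (∈-vertices (fromℕ< v<n))))

    step⁻ : ∀ S A w → mem (step G S A) w ≡ true →
            mem A w ≡ true ⊎ (mem S w ≡ true × ∃ λ v → mem A v ≡ true × E v w ≡ true)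
    step⁻ S A w w∈ with ∨≡true⁻ (trans (sym (mem-step S A w w<n)) w∈)
      where w<n = mem⇒< (step G S A) w w∈
    ... | inj₁ w∈A = inj₁ w∈A
    ... | inj₂ w∈S∧adjacent with ∧≡true⁻ w∈S∧adjacent
    ... | w∈S , adjacent with Any.satisfied (any⁻ _ vertices (Equivalence.from T-≡ adjacent))
    ... | v , T-edge with ∧≡true⁻ (Equivalence.to T-≡ T-edge)
    ... | v∈A , vw = inj₂ (w∈S , toℕ v , trans (mem-lookup A v) v∈A , trans (cong (E (toℕ v)) (sym (toℕ-fromℕ< _))) vw)

    iter-suc : ∀ i (f : Subset n → Subset n) A → iter (suc i) f A ≡ f (iter i f A)
    iter-suc zero f A = refl
    iter-suc (suc i) f A = iter-suc i f (f A)

    iter-mono : ∀ S A w {i j} → i ≤ j → mem (iter i (step G S) A) w ≡ true → mem (iter j (step G S) A) w ≡ true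
    iter-mono S A w {j = zero} z≤n w∈ = w∈
    iter-mono S A w {i} {suc j} i≤1+j w∈ with m≤n⇒m<n∨m≡n i≤1+j
    ... | inj₂ refl = w∈
    ... | inj₁ i<1+j = subst (λ B → mem B w ≡ true) (sym (iter-suc j (step G S) A))
                         (step-⊇ S (iter j (step G S) A) w (iter-mono S A w (≤-pred i<1+j) w∈))

    iter-⊆ : ∀ S i A → A ⊆ₘ S → iter i (step G S) A ⊆ₘ S
    iter-⊆ S zero A A⊆S = A⊆S
    iter-⊆ S (suc i) A A⊆S = iter-⊆ S i (step G S A) step⊆S
      where
      step⊆S : step G S A ⊆ₘ S
      step⊆S w w∈ with step⁻ S A w w∈
      ... | inj₁ w∈A = A⊆S w w∈A
      ... | inj₂ (w∈S , _) = w∈S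

    data Walk (S A : Subset n) : ℕ → ℕ → Set where
      start : ∀ {w} → mem A w ≡ true → Walk S A 0 w
      extend : ∀ {d v w} → Walk S A d v → E v w ≡ true → mem S w ≡ true → Walk S A (suc d) w

    Walk⇒iter : ∀ S A {d w} → Walk S A d w → mem (iter d (step G S) A) w ≡ true
    Walk⇒iter S A (start w∈A) = w∈A
    Walk⇒iter S A {suc d} {w} (extend {v = v} walk vw w∈S) =
      subst (λ B → mem B w ≡ true) (sym (iter-suc d (step G S) A)) (step-edge S (iter d (step G S) A) v w (Walk⇒iter S A walk) vw w∈S)

    data Reach (S A : Subset n) : ℕ → Set where
      start : ∀ {w} → mem A w ≡ true → Reach S A w
      extend : ∀ {v w} → Reach S A v → E v w ≡ true → mem S w ≡ true → Reach S A w

    Reach-ind : ∀ {S A} (P : ℕ → Set) → (∀ w → mem A w ≡ true → P w) →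
                (∀ v w → P v → E v w ≡ true → mem S w ≡ true → P w) → ∀ w → Reach S A w → P w
    Reach-ind P P-start P-extend w (start w∈A) = P-start w w∈A
    Reach-ind P P-start P-extend w (extend reach vw w∈S) = P-extend _ w (Reach-ind P P-start P-extend _ reach) vw w∈S

    iter⇒Reach : ∀ S i A w → mem (iter i (step G S) A) w ≡ true → Reach S A w
    iter⇒Reach S zero A w w∈A = start w∈A
    iter⇒Reach S (suc i) A w w∈ = from-step w (iter⇒Reach S i (step G S A) w w∈)
      where
      from-step : ∀ w → Reach S (step G S A) w → Reach S A w
      from-step w (start w∈) with step⁻ S A w w∈
      ... | inj₁ w∈A = start w∈A
      ... | inj₂ (w∈S , v , v∈A , vw) = extend (start v∈A) vw w∈S
      from-step w (extend reach vw w∈S) = extend (from-step _ reach) vw w∈S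

    connectedᵇ⁻ : ∀ S → connectedᵇ G S ≡ true → Empty S ⊎ (∀ w → mem S w ≡ true → Reach S (firstElem S) w)
    connectedᵇ⁻ S connected with ∨≡true⁻ connected
    ... | inj₁ empty = inj₁ (isEmptyᵇ≡true⁻ S empty)
    ... | inj₂ closure≡S = inj₂ λ w w∈ →
      iter⇒Reach S n (firstElem S) w (trans (eqSubᵇ≡true⁻ (iter n (step G S) (firstElem S)) S closure≡S w) w∈)

    connectedᵇ-Empty : ∀ S → Empty S → connectedᵇ G S ≡ true
    connectedᵇ-Empty S empty rewrite isEmptyᵇ≡true⁺ S empty = refl

    connectedᵇ⁺ : ∀ S → (∀ w → mem S w ≡ true → ∃ λ d → d ≤ n × Walk S (firstElem S) d w) → connectedᵇ G S ≡ true
    connectedᵇ⁺ S walks = trans (cong (isEmptyᵇ S ∨_) (eqSubᵇ≡true⁺ (iter n (step G S) (firstElem S)) S closure≡S)) (∨-zeroʳ _)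
      where
      closure≡S : ∀ i → mem (iter n (step G S) (firstElem S)) i ≡ mem S i
      closure≡S i with mem S i in i∈?
      ... | true = let (d , d≤n , walk) = walks i i∈? in iter-mono S _ i d≤n (Walk⇒iter S _ walk)
      ... | false = ¬-not λ i∈ → contradiction i∈? (≡true⇒≢false (iter-⊆ S n _ first⊆S i i∈))
        where
        first⊆S : firstElem S ⊆ₘ S
        first⊆S w w∈ = proj₁ (mem-firstElem⁻ S w w∈)

module Shapes where

  open Booleans
  open Subsets
  open Game
  open import Data.Bool using (Bool; true; false; _∧_; _∨_; not)
  open import Data.Bool.Properties using (∨-zeroʳ; ∧-identityʳ; ¬-not)
  open import Data.Nat
  open import Data.Nat.Properties
  open import Data.Fin.Subset using (Subset; _─_; ∣_∣)
  open import Data.Product using (∃; _×_; _,_; proj₁; proj₂)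
  open import Data.Sum using (_⊎_; inj₁; inj₂)
  open import Function using (_∘_)
  open import Relation.Nullary using (yes; no; contradiction)
  open import Relation.Binary.PropositionalEquality

  bounded-search : ∀ (φ : ℕ → Bool) b → (∃ λ l → l < b × φ l ≡ true) ⊎ (∀ l → l < b → φ l ≡ false)
  bounded-search φ zero = inj₂ λ _ ()
  bounded-search φ (suc b) with bounded-search φ b
  ... | inj₁ (l , l<b , φl) = inj₁ (l , m<n⇒m<1+n l<b , φl)
  ... | inj₂ none<b with φ b in φb
  ... | true = inj₁ (b , ≤-refl , φb)
  ... | false = inj₂ λ l l<1+b → case-split l (m≤n⇒m<n∨m≡n (≤-pred l<1+b))
    where
    case-split : ∀ l → l < b ⊎ l ≡ b → φ l ≡ false
    case-split l (inj₁ l<b) = none<b l l<b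
    case-split l (inj₂ refl) = φb

  module StarPath (t k : ℕ) where

    n : ℕ
    n = suc (t + k)

    E : ℕ → ℕ → Bool
    E a b = edgeℕ t a b ∨ edgeℕ t b a

    open Connectivity E n public

    data Edge (a b : ℕ) : Set where
      centre→ : a ≡ 0 → 1 ≤ b → b ≤ suc t → Edge a b
      →centre : b ≡ 0 → 1 ≤ a → a ≤ suc t → Edge a b
      path→   : suc t ≤ a → b ≡ suc a → Edge a b
      →path   : suc t ≤ b → a ≡ suc b → Edge a b

    private
      edgeℕ-cases : ∀ a b → edgeℕ t a b ≡ true → (a ≡ 0 × 1 ≤ b × b ≤ suc t) ⊎ (suc t ≤ a × b ≡ suc a)
      edgeℕ-cases a b ab with ∨≡true⁻ ab
      ... | inj₁ centre with ∧≡true⁻ centre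
      ... | a≡0 , rest = let (1≤b , b≤1+t) = ∧≡true⁻ rest in inj₁ (≡ᵇ≡true⇒≡ a≡0 , ≤ᵇ≡true⇒≤ 1≤b , ≤ᵇ≡true⇒≤ b≤1+t)
      edgeℕ-cases a b ab | inj₂ path = let (1+t≤a , b≡1+a) = ∧≡true⁻ path in inj₂ (≤ᵇ≡true⇒≤ 1+t≤a , ≡ᵇ≡true⇒≡ b≡1+a)

    edge-cases : ∀ a b → E a b ≡ true → Edge a b
    edge-cases a b ab with ∨≡true⁻ ab
    ... | inj₁ forward with edgeℕ-cases a b forward
    ... | inj₁ (a≡0 , 1≤b , b≤1+t) = centre→ a≡0 1≤b b≤1+t
    ... | inj₂ (1+t≤a , b≡1+a) = path→ 1+t≤a b≡1+a
    edge-cases a b ab | inj₂ backward with edgeℕ-cases b a backward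
    ... | inj₁ (b≡0 , 1≤a , a≤1+t) = →centre b≡0 1≤a a≤1+t
    ... | inj₂ (1+t≤b , a≡1+b) = →path 1+t≤b a≡1+b

    centre-edge : ∀ b → 1 ≤ b → b ≤ suc t → E 0 b ≡ true
    centre-edge b 1≤b b≤1+t rewrite ≤⇒≤ᵇ≡true 1≤b | ≤⇒≤ᵇ≡true b≤1+t = refl

    path-edge : ∀ a → suc t ≤ a → E a (suc a) ≡ true
    path-edge a 1+t≤a rewrite ≤⇒≤ᵇ≡true 1+t≤a | ≡⇒≡ᵇ≡true (refl {x = a}) =
      cong (_∨ edgeℕ t (suc a) a) (∨-zeroʳ ((a ≡ᵇ 0) ∧ (a <ᵇ suc t)))

    edge-below-path-vertex : ∀ p v w → suc t ≤ p → v < p → E v w ≡ true → w ≤ p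
    edge-below-path-vertex p v w 1+t≤p v<p vw with edge-cases v w vw
    ... | centre→ _ _ w≤1+t = ≤-trans w≤1+t 1+t≤p
    ... | →centre refl _ _ = z≤n
    ... | path→ _ refl = v<p
    ... | →path _ refl = ≤-trans (n≤1+n w) (<⇒≤ v<p)

    leaf-edge : ∀ l w → 1 ≤ l → l ≤ t → E l w ≡ true → w ≡ 0
    leaf-edge l w 1≤l l≤t lw with edge-cases l w lw
    ... | centre→ refl _ _ = contradiction 1≤l λ ()
    ... | →centre w≡0 _ _ = w≡0
    ... | path→ 1+t≤l _ = contradiction (≤-trans 1+t≤l l≤t) 1+n≰n
    ... | →path 1+t≤w refl = contradiction (≤-trans 1+t≤w (≤-trans (n≤1+n w) l≤t)) 1+n≰n

    record Star (W : Subset n) (j : ℕ) : Set where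
      field
        centre∈ : mem W 0 ≡ true
        j≤k : j ≤ k
        path∈ : ∀ i → suc t ≤ i → mem W i ≡ (i <ᵇ suc t + j)

    record Segment (W : Subset n) (a m : ℕ) : Set where
      field
        0<a : 0 < a
        0<m : 0 < m
        leaf⊎path : m ≡ 1 ⊎ suc t ≤ a
        a+m≤n : a + m ≤ n
        interval∈ : ∀ i → mem W i ≡ intervalᵇ a m i

    open Star public
    open Segment public

    Segment-bounds : ∀ {W a m x} → Segment W a m → mem W x ≡ true → a ≤ x × x < a + m
    Segment-bounds {a = a} {m} {x} W-segment x∈ = intervalᵇ≡true⇒ {a} {m} (trans (sym (interval∈ W-segment x)) x∈)

    Segment₁⇒≡ : ∀ {W a x} → Segment W a 1 → mem W x ≡ true → x ≡ a
    Segment₁⇒≡ {a = a} {x} W-segment x∈ =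
      let (a≤x , x<a+1) = Segment-bounds W-segment x∈ in ≤-antisym (≤-pred (subst (x <_) (+-comm a 1) x<a+1)) a≤x

    Segment⇒0∉ : ∀ {W a m} → Segment W a m → mem W 0 ≡ false
    Segment⇒0∉ {a = a} {m} W-segment = trans (interval∈ W-segment 0) (<⇒intervalᵇ≡false {a} {m} (0<a W-segment))

    Segment⇒a∈ : ∀ {W a m} → Segment W a m → mem W a ≡ true
    Segment⇒a∈ {a = a} W-segment = trans (interval∈ W-segment a) (intervalᵇ≡true ≤-refl (m<m+n a (0<m W-segment)))

    leaf-Segment⇒m≡1 : ∀ {W a m} → Segment W a m → a ≤ t → m ≡ 1
    leaf-Segment⇒m≡1 W-segment a≤t with leaf⊎path W-segment
    ... | inj₁ m≡1 = m≡1
    ... | inj₂ 1+t≤a = contradiction (≤-trans 1+t≤a a≤t) 1+n≰n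

    Segment⊆Star⇒≤ : ∀ {W a m Y j} → Segment W a m → Star Y j → W ⊆ₘ Y → suc t ≤ a → a + m ≤ suc t + j
    Segment⊆Star⇒≤ {W} {a} {m} {Y} {j} W-segment Y-star W⊆Y 1+t≤a =
      subst (_≤ suc t + j) a+m≡1+top (<ᵇ≡true⇒< (trans (sym (path∈ Y-star top (≤-trans 1+t≤a (m≤m+n a _)))) (W⊆Y top top∈)))
      where
      top = a + (m ∸ 1)
      a+m≡1+top : suc top ≡ a + m
      a+m≡1+top = trans (sym (+-suc a (m ∸ 1))) (cong (a +_) (m+[n∸m]≡n (0<m W-segment)))
      top∈ : mem W top ≡ true
      top∈ = trans (interval∈ W-segment top) (intervalᵇ≡true (m≤m+n a _) (subst (top <_) a+m≡1+top ≤-refl))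

    PrefixClosed : Subset n → Set
    PrefixClosed W = ∀ p q → suc t ≤ p → p < q → mem W q ≡ true → mem W p ≡ true

    data Shape (W : Subset n) : Set where
      empty : Empty W → Shape W
      star : mem W 0 ≡ true → PrefixClosed W → Shape W
      segment : ∀ a m → Segment W a m → Shape W

    singleton-Segment : ∀ W l → 0 < l → l < n → mem W l ≡ true → (∀ y → mem W y ≡ true → y ≡ l) → Segment W l 1
    singleton-Segment W l 0<l l<n l∈ only-l = record
      { 0<a = 0<l ; 0<m = z<s ; leaf⊎path = inj₁ refl ; a+m≤n = subst (_≤ n) (+-comm 1 l) l<n ; interval∈ = interval∈′ }
      where
      interval∈′ : ∀ i → mem W i ≡ intervalᵇ l 1 i
      interval∈′ i with mem W i in i∈?
      ... | true rewrite only-l i i∈? = sym (intervalᵇ≡true ≤-refl (m<m+n l z<s))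
      ... | false = sym (¬-not λ i∈interval →
        let (l≤i , i<l+1) = intervalᵇ≡true⇒ i∈interval
        in contradiction (subst (λ x → mem W x ≡ false) (≤-antisym (≤-pred (subst (i <_) (+-comm l 1) i<l+1)) l≤i) i∈?)
                         (≡true⇒≢false l∈))

    IntervalClosed : Subset n → Set
    IntervalClosed W = ∀ x p y → x < p → p < y → mem W x ≡ true → mem W y ≡ true → mem W p ≡ true

    interval-Segment : ∀ W lo hi → suc t ≤ lo → mem W lo ≡ true → mem W hi ≡ true →
                       (∀ y → mem W y ≡ true → lo ≤ y) → (∀ y → mem W y ≡ true → y ≤ hi) → IntervalClosed W →
                       Segment W lo (suc hi ∸ lo)
    interval-Segment W lo hi 1+t≤lo lo∈ hi∈ least greatest closed = record
      { 0<a = ≤-trans z<s 1+t≤lo ; 0<m = m<n⇒0<n∸m (s≤s lo≤hi) ; leaf⊎path = inj₂ 1+t≤lo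
      ; a+m≤n = subst (_≤ n) (sym lo+m≡1+hi) (mem⇒< W hi hi∈) ; interval∈ = interval∈′ }
      where
      lo≤hi = greatest lo lo∈
      lo+m≡1+hi : lo + (suc hi ∸ lo) ≡ suc hi
      lo+m≡1+hi = m+[n∸m]≡n (≤-trans lo≤hi (n≤1+n hi))
      interval∈′ : ∀ i → mem W i ≡ intervalᵇ lo (suc hi ∸ lo) i
      interval∈′ i with i <? lo | i ≤? hi
      ... | yes i<lo | _ = trans (¬-not λ i∈ → <⇒≱ i<lo (least i i∈)) (sym (<⇒intervalᵇ≡false i<lo))
      ... | no _ | no i≰hi = trans (¬-not λ i∈ → i≰hi (greatest i i∈))
                                   (sym (≥⇒intervalᵇ≡false {lo} {suc hi ∸ lo} (subst (_≤ i) (sym lo+m≡1+hi) (≰⇒> i≰hi))))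
      ... | no i≮lo | yes i≤hi = trans i∈ (sym (intervalᵇ≡true (≮⇒≥ i≮lo) (subst (i <_) (sym lo+m≡1+hi) (s≤s i≤hi))))
        where
        i∈ : mem W i ≡ true
        i∈ with m≤n⇒m<n∨m≡n (≮⇒≥ i≮lo) | m≤n⇒m<n∨m≡n i≤hi
        ... | inj₂ refl | _ = lo∈
        ... | inj₁ _ | inj₂ refl = hi∈
        ... | inj₁ lo<i | inj₁ i<hi = closed lo i hi lo<i i<hi lo∈ hi∈

    Reach-below : ∀ W p → suc t ≤ p → mem W p ≡ false → (∀ w → mem (firstElem W) w ≡ true → w < p) →
                  ∀ w → Reach W (firstElem W) w → w < p
    Reach-below W p 1+t≤p p∉ first<p = Reach-ind (_< p) first<p λ v w v<p vw w∈ →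
      ≤∧≢⇒< (edge-below-path-vertex p v w 1+t≤p v<p vw) λ { refl → contradiction p∉ (≡true⇒≢false w∈) }

    shape : ∀ W → connectedᵇ G W ≡ true → Shape W
    shape W connected with empty⊎member W | connectedᵇ⁻ W connected
    ... | inj₁ W-empty | _ = empty W-empty
    ... | inj₂ _ | inj₁ W-empty = empty W-empty
    ... | inj₂ (x , x∈) | inj₂ reach with mem W 0 in 0∈?
    ... | true = star 0∈? prefix-closed
      where
      prefix-closed : PrefixClosed W
      prefix-closed p q 1+t≤p p<q q∈ = ¬-not λ p∉ → <⇒≯ p<q (Reach-below W p 1+t≤p p∉ first<p q (reach q q∈))
        where
        first<p : ∀ w → mem (firstElem W) w ≡ true → w < p
        first<p w w∈first with proj₂ (mem-firstElem⁻ W w w∈first) 0 0∈?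
        ... | z≤n = ≤-trans z<s 1+t≤p
    ... | false with bounded-search (λ l → mem W (suc l)) t
    ... | inj₁ (l , l<t , l∈) = segment (suc l) 1 (singleton-Segment W (suc l) z<s (s≤s (≤-trans l<t (m≤m+n t k))) l∈ only-l)
      where
      in-first : ∀ y → mem W y ≡ true → mem (firstElem W) y ≡ true
      in-first y y∈ = Reach-ind (λ w → mem (firstElem W) w ≡ true) (λ _ w∈ → w∈) no-extension y (reach y y∈)
        where
        no-extension : ∀ v w → mem (firstElem W) v ≡ true → E v w ≡ true → mem W w ≡ true → mem (firstElem W) w ≡ true
        no-extension v w v∈first vw w∈ =
          contradiction 0∈? (≡true⇒≢false (subst (λ u → mem W u ≡ true) (leaf-edge v w 0<v v≤t vw) w∈))
          where
          v∈ = proj₁ (mem-firstElem⁻ W v v∈first)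
          v≤t = ≤-trans (proj₂ (mem-firstElem⁻ W v v∈first) (suc l) l∈) l<t
          0<v = n≢0⇒n>0 λ { refl → contradiction 0∈? (≡true⇒≢false v∈) }
      only-l : ∀ y → mem W y ≡ true → y ≡ suc l
      only-l y y∈ = ≤-antisym (proj₂ (mem-firstElem⁻ W y (in-first y y∈)) (suc l) l∈)
                              (proj₂ (mem-firstElem⁻ W (suc l) (in-first (suc l) l∈)) y y∈)
    ... | inj₂ no-leaf = segment lo _ (interval-Segment W lo hi (beyond-leaves lo lo∈) lo∈ hi∈ least greatest closed)
      where
      beyond-leaves : ∀ y → mem W y ≡ true → suc t ≤ y
      beyond-leaves zero y∈ = contradiction 0∈? (≡true⇒≢false y∈)
      beyond-leaves (suc y) y∈ with suc y ≤? t
      ... | yes y<t = contradiction (no-leaf y y<t) (≡true⇒≢false y∈)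
      ... | no y≮t = ≰⇒> y≮t
      closed : IntervalClosed W
      closed x p y x<p p<y x∈ y∈ = ¬-not λ p∉ → <⇒≯ p<y (Reach-below W p 1+t≤p p∉ first<p y (reach y y∈))
        where
        1+t≤p = ≤-trans (beyond-leaves x x∈) (<⇒≤ x<p)
        first<p : ∀ w → mem (firstElem W) w ≡ true → w < p
        first<p w w∈first = ≤-<-trans (proj₂ (mem-firstElem⁻ W w w∈first) x x∈) x<p
      lo = proj₁ (least-member W x x∈)
      lo∈ = proj₁ (proj₂ (least-member W x x∈))
      least = proj₂ (proj₂ (least-member W x x∈))
      hi = proj₁ (greatest-member W x x∈)
      hi∈ = proj₁ (proj₂ (greatest-member W x x∈))
      greatest = proj₂ (proj₂ (greatest-member W x x∈))

    Star-connected : ∀ Y j → Star Y j → connectedᵇ G Y ≡ true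
    Star-connected Y j Y-star = connectedᵇ⁺ Y walk
      where
      0∈first : mem (firstElem Y) 0 ≡ true
      0∈first = mem-firstElem⁺ Y 0 (centre∈ Y-star) λ _ ()
      path∈′ : ∀ p → p < j → mem Y (suc t + p) ≡ true
      path∈′ p p<j = trans (path∈ Y-star (suc t + p) (m≤m+n (suc t) p)) (<⇒<ᵇ≡true (+-monoʳ-< (suc t) p<j))
      path-walk : ∀ p → p < j → Walk Y (firstElem Y) (suc p) (suc t + p)
      path-walk zero 0<j =
        extend (start 0∈first) (centre-edge (suc t + 0) z<s (≤-reflexive (+-identityʳ (suc t)))) (path∈′ 0 0<j)
      path-walk (suc p) 1+p<j =
        extend (path-walk p (<-trans (n<1+n p) 1+p<j))
               (subst (λ w → E (suc t + p) w ≡ true) (sym (+-suc (suc t) p)) (path-edge (suc t + p) (m≤m+n (suc t) p)))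
               (path∈′ (suc p) 1+p<j)
      walk : ∀ w → mem Y w ≡ true → ∃ λ d → d ≤ n × Walk Y (firstElem Y) d w
      walk zero _ = 0 , z≤n , start 0∈first
      walk (suc w) w∈ with suc w ≤? t
      ... | yes w<t = 1 , s≤s z≤n , extend (start 0∈first) (centre-edge (suc w) (s≤s z≤n) (m≤n⇒m≤1+n w<t)) w∈
      ... | no w≮t = suc p , s≤s (≤-trans (<⇒≤ p<j) (≤-trans (j≤k Y-star) (m≤n+m k t))) ,
                     subst (Walk Y (firstElem Y) (suc p)) 1+t+p≡1+w (path-walk p p<j)
        where
        1+t≤1+w = ≰⇒> w≮t
        p = suc w ∸ suc t
        1+t+p≡1+w : suc t + p ≡ suc w
        1+t+p≡1+w = m+[n∸m]≡n 1+t≤1+w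
        p<j : p < j
        p<j = +-cancelˡ-< (suc t) p j (subst (_< suc t + j) (sym 1+t+p≡1+w)
                (<ᵇ≡true⇒< (trans (sym (path∈ Y-star (suc w) 1+t≤1+w)) w∈)))

    Segment-connected : ∀ W a m → Segment W a m → connectedᵇ G W ≡ true
    Segment-connected W a m W-segment = connectedᵇ⁺ W walk
      where
      a∈first : mem (firstElem W) a ≡ true
      a∈first = mem-firstElem⁺ W a (trans (interval∈ W-segment a) (intervalᵇ≡true ≤-refl (m<m+n a (0<m W-segment))))
                  λ y y<a → trans (interval∈ W-segment y) (<⇒intervalᵇ≡false y<a)
      segment-walk : ∀ d → d < m → Walk W (firstElem W) d (a + d)
      segment-walk zero _ = start (subst (λ w → mem (firstElem W) w ≡ true) (sym (+-identityʳ a)) a∈first)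
      segment-walk (suc d) 1+d<m with leaf⊎path W-segment
      ... | inj₁ refl = contradiction (≤-pred 1+d<m) λ ()
      ... | inj₂ 1+t≤a = extend (segment-walk d (<-trans (n<1+n d) 1+d<m))
                          (subst (λ w → E (a + d) w ≡ true) (sym (+-suc a d)) (path-edge (a + d) (≤-trans 1+t≤a (m≤m+n a d))))
                          (trans (interval∈ W-segment (a + suc d)) (intervalᵇ≡true (m≤m+n a _) (+-monoʳ-< a 1+d<m)))
      walk : ∀ w → mem W w ≡ true → ∃ λ d → d ≤ n × Walk W (firstElem W) d w
      walk w w∈ = d , ≤-trans (<⇒≤ d<m) (≤-trans (m≤n+m m a) (a+m≤n W-segment)) ,
                  subst (Walk W (firstElem W) d) a+d≡w (segment-walk d d<m)
        where
        bounds = Segment-bounds W-segment w∈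
        d = w ∸ a
        a+d≡w : a + d ≡ w
        a+d≡w = m+[n∸m]≡n (proj₁ bounds)
        d<m : d < m
        d<m = +-cancelˡ-< a d m (subst (_< a + m) (sym a+d≡w) (proj₂ bounds))

    Segment⇒∣∣≡ : ∀ W a m → Segment W a m → ∣ W ∣ ≡ m
    Segment⇒∣∣≡ W a m W-segment =
      trans (∣∣≡count W) (trans (count-cong n λ i _ → interval∈ W-segment i) (count-intervalᵇ n a m (a+m≤n W-segment)))

    leafCount : Subset n → ℕ
    leafCount W = count (mem W ∘ suc) t

    Star⇒∣∣≡ : ∀ W j → Star W j → ∣ W ∣ ≡ leafCount W + suc j
    Star⇒∣∣≡ W j W-star = begin
      ∣ W ∣                                                 ≡⟨ ∣∣≡count W ⟩
      count (mem W) n                                       ≡⟨ count-true (t + k) (mem W) (centre∈ W-star) ⟩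
      suc (count (mem W ∘ suc) (t + k))                     ≡⟨ cong suc (count-+ t k (mem W ∘ suc)) ⟩
      suc (leafCount W + count (mem W ∘ suc ∘ (t +_)) k)    ≡⟨ cong (λ c → suc (leafCount W + c)) path-count ⟩
      suc (leafCount W + j)                                 ≡⟨ +-suc (leafCount W) j ⟨
      leafCount W + suc j                                   ∎
      where
      open ≡-Reasoning
      path-count : count (mem W ∘ suc ∘ (t +_)) k ≡ j
      path-count = trans (count-cong k λ p _ → trans (path∈ W-star (suc t + p) (m≤m+n (suc t) p)) (+-cancelˡ-<ᵇ t))
                         (count-<ᵇ (j≤k W-star))

    leafCount>0⇒leaf∈ : ∀ W → 0 < leafCount W → ∃ λ l → 0 < l × l ≤ t × mem W l ≡ true
    leafCount>0⇒leaf∈ W 0<count with count>0⇒witness t (mem W ∘ suc) 0<count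
    ... | l , l<t , l∈ = suc l , z<s , l<t , l∈

    leaf∈⇒leafCount>0 : ∀ W l → 0 < l → l ≤ t → mem W l ≡ true → 0 < leafCount W
    leaf∈⇒leafCount>0 W (suc l) _ l<t l∈ = witness⇒count>0 t (mem W ∘ suc) l l<t l∈

    Star-─-leaves : ∀ Y j X → Star Y j → mem X 0 ≡ false → (∀ i → mem X i ≡ true → i ≤ t) → Star (Y ─ X) j
    Star-─-leaves Y j X Y-star 0∉X X⊆leaves = record
      { centre∈ = trans (mem-─ Y X 0) (cong₂ (λ a b → a ∧ not b) (centre∈ Y-star) 0∉X)
      ; j≤k = j≤k Y-star
      ; path∈ = λ i 1+t≤i → trans (mem-─ Y X i) (trans (cong (λ b → mem Y i ∧ not b) (i∉X i 1+t≤i))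
                                   (trans (∧-identityʳ (mem Y i)) (path∈ Y-star i 1+t≤i)))
      }
      where
      i∉X : ∀ i → suc t ≤ i → mem X i ≡ false
      i∉X i 1+t≤i = ¬-not λ i∈X → 1+n≰n (≤-trans 1+t≤i (X⊆leaves i i∈X))

    Star-─-tail : ∀ Y j X d i → Star Y j → Segment X (suc t + d) i → d + i ≡ j → Star (Y ─ X) d
    Star-─-tail Y j X d i Y-star X-segment d+i≡j = record
      { centre∈ = trans (mem-─ Y X 0) (cong₂ (λ a b → a ∧ not b) (centre∈ Y-star) (Segment⇒0∉ X-segment))
      ; j≤k = ≤-trans (subst (d ≤_) d+i≡j (m≤m+n d i)) (j≤k Y-star)
      ; path∈ = path∈′
      }
      where
      top≡ : suc t + d + i ≡ suc t + j
      top≡ = trans (+-assoc (suc t) d i) (cong (suc t +_) d+i≡j)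
      path∈′ : ∀ p → suc t ≤ p → mem (Y ─ X) p ≡ (p <ᵇ suc t + d)
      path∈′ p 1+t≤p = begin
        mem (Y ─ X) p                                         ≡⟨ mem-─ Y X p ⟩
        mem Y p ∧ not (mem X p)                               ≡⟨ cong₂ (λ a b → a ∧ not b) (path∈ Y-star p 1+t≤p) (interval∈ X-segment p) ⟩
        (p <ᵇ suc t + j) ∧ not (intervalᵇ (suc t + d) i p)    ≡⟨ cong (λ c → (p <ᵇ c) ∧ not (intervalᵇ (suc t + d) i p)) top≡ ⟨
        (p <ᵇ suc t + d + i) ∧ not (intervalᵇ (suc t + d) i p) ≡⟨ <ᵇ-∧-not-intervalᵇ (suc t + d) i p ⟩
        (p <ᵇ suc t + d)                                      ∎
        where open ≡-Reasoning

module Correspondence where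

  open Mex
  open Recurrence
  open Booleans
  open Subsets
  open Game
  open Shapes
  open import Data.Bool using (Bool; true; false; _∧_; not)
  open import Data.Bool.Properties using (∧-inverseʳ; ∧-identityʳ; ∧-zeroʳ; ∧-assoc)
  open import Data.Nat
  open import Data.Nat.Properties
  open import Data.Nat.DivMod using (_%_)
  open import Data.Fin.Subset using (Subset; _─_; ∣_∣)
  open import Data.Product using (∃; _×_; _,_; proj₁; proj₂)
  open import Data.Sum using (_⊎_; inj₁; inj₂)
  open import Relation.Nullary using (yes; no; contradiction)
  open import Relation.Binary.PropositionalEquality
  open import Data.Nat.Tactic.RingSolver using (solve-∀)

  module StarPathValues (N : ℕ) (0<N : 0 < N) (Q : ℕ → ℕ → ℕ) (t k : ℕ) where

    open StarPath t k
    open StarRecurrence N Q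
    open PathRecurrence N

    -- ∣ Z ∣ ∸ suc j is the number of leaves of a star position Z (Star⇒∣∣≡).
    record ValuesBelow (fuel size : ℕ) : Set where
      field
        star-value : ∀ Z j → Star Z j → ∣ Z ∣ < size → grundyF fuel (I N) G Z ≡ Q (∣ Z ∣ ∸ suc j) j
        segment-value : ∀ Z a m → Segment Z a m → ∣ Z ∣ < size → grundyF fuel (I N) G Z ≡ m % suc N

    segment-subset : ∀ a m → 0 < a → 0 < m → m ≡ 1 ⊎ suc t ≤ a → a + m ≤ n → ∃ λ X → Segment X a m
    segment-subset a m 0<a 0<m leaf⊎path a+m≤n = fromPred n (intervalᵇ a m) , record
      { 0<a = 0<a ; 0<m = 0<m ; leaf⊎path = leaf⊎path ; a+m≤n = a+m≤n
      ; interval∈ = mem-fromPred n (intervalᵇ a m) λ i n≤i → ≥⇒intervalᵇ≡false {a} {m} (≤-trans a+m≤n n≤i) }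

    module _ {fuel : ℕ} {Y : Subset n} (values : ValuesBelow fuel ∣ Y ∣) where

      open ValuesBelow values

      take-segment : ∀ X a i j → Segment X a i → X ⊆ₘ Y → Star (Y ─ X) j → i ≤ N →
                     MoveValue N G (grundyF fuel (I N) G) Y (Q (∣ Y ─ X ∣ ∸ suc j) j)
      take-segment X a i j X-segment X⊆Y rest-star i≤N = X , move , sym (star-value (Y ─ X) j rest-star rest<Y)
        where
        ∣X∣≡i = Segment⇒∣∣≡ X a i X-segment
        rest<Y : ∣ Y ─ X ∣ < ∣ Y ∣
        rest<Y = subst (∣ Y ─ X ∣ <_) (∣─∣+∣∣≡∣∣ Y X X⊆Y) (m<m+n _ (subst (0 <_) (sym ∣X∣≡i) (0<m X-segment)))
        move : Move N G Y X
        move = record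
          { X⊆Y = X⊆Y
          ; 0<∣X∣ = subst (0 <_) (sym ∣X∣≡i) (0<m X-segment)
          ; ∣X∣≤N = subst (_≤ N) (sym ∣X∣≡i) i≤N
          ; X-connected = Segment-connected X a i X-segment
          ; rest-connected = Star-connected (Y ─ X) j rest-star
          }

      leave-segment : ∀ R a m j → Segment R a m → R ⊆ₘ Y → Star (Y ─ R) j → ∣ Y ∣ ≤ N + m →
                      MoveValue N G (grundyF fuel (I N) G) Y (m % suc N)
      leave-segment R a m j R-segment R⊆Y X-star ∣Y∣≤N+m = Y ─ R , move , sym (segment-value (Y ─ (Y ─ R)) a m rest-segment rest<Y)
        where
        X = Y ─ R
        rest-segment : Segment (Y ─ X) a m
        rest-segment = record { 0<a = 0<a R-segment ; 0<m = 0<m R-segment ; leaf⊎path = leaf⊎path R-segment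
                              ; a+m≤n = a+m≤n R-segment ; interval∈ = λ i → trans (mem-─-─ Y R R⊆Y i) (interval∈ R-segment i) }
        m+∣X∣≡∣Y∣ : m + ∣ X ∣ ≡ ∣ Y ∣
        m+∣X∣≡∣Y∣ = trans (cong (_+ ∣ X ∣) (sym (Segment⇒∣∣≡ (Y ─ X) a m rest-segment))) (∣─∣+∣∣≡∣∣ Y X (─-⊆ Y R))
        0<∣X∣ : 0 < ∣ X ∣
        0<∣X∣ = subst (0 <_) (sym (Star⇒∣∣≡ X j X-star)) (<-≤-trans z<s (m≤n+m (suc j) (leafCount X)))
        rest<Y : ∣ Y ─ X ∣ < ∣ Y ∣
        rest<Y = subst (∣ Y ─ X ∣ <_) (∣─∣+∣∣≡∣∣ Y X (─-⊆ Y R)) (m<m+n _ 0<∣X∣)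
        move : Move N G Y X
        move = record
          { X⊆Y = ─-⊆ Y R
          ; 0<∣X∣ = 0<∣X∣
          ; ∣X∣≤N = +-cancelˡ-≤ m _ _ (subst₂ _≤_ (sym m+∣X∣≡∣Y∣) (+-comm N m) ∣Y∣≤N+m)
          ; X-connected = Star-connected X j X-star
          ; rest-connected = Segment-connected (Y ─ X) a m rest-segment
          }

    suc[1+s+j]≡s+1+j+1 : ∀ s j → suc (suc s + j) ≡ s + suc j + 1
    suc[1+s+j]≡s+1+j+1 = solve-∀

    Star⇒∣∣≡s+1+j : ∀ Y j → Star Y j → ∣ Y ∣ ≡ (∣ Y ∣ ∸ suc j) + suc j
    Star⇒∣∣≡s+1+j Y j Y-star = sym (m∸n+n≡m (subst (suc j ≤_) (sym (Star⇒∣∣≡ Y j Y-star)) (m≤n+m (suc j) (leafCount Y))))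

    leaves≡ : ∀ Y j → Star Y j → ∣ Y ∣ ∸ suc j ≡ leafCount Y
    leaves≡ Y j Y-star = trans (cong (_∸ suc j) (Star⇒∣∣≡ Y j Y-star)) (m+n∸n≡m (leafCount Y) (suc j))

    ∣─∣∸≡ : ∀ (Y X : Subset n) s d i → X ⊆ₘ Y → ∣ X ∣ ≡ i → ∣ Y ∣ ≡ s + suc d + i → ∣ Y ─ X ∣ ∸ suc d ≡ s
    ∣─∣∸≡ Y X s d i X⊆Y ∣X∣≡i ∣Y∣≡ = trans (cong (_∸ suc d) ∣rest∣≡) (m+n∸n≡m s (suc d))
      where
      ∣rest∣≡ : ∣ Y ─ X ∣ ≡ s + suc d
      ∣rest∣≡ = +-cancelʳ-≡ i _ _ (trans (cong (∣ Y ─ X ∣ +_) (sym ∣X∣≡i)) (trans (∣─∣+∣∣≡∣∣ Y X X⊆Y) ∣Y∣≡))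

    module StarMoves {Y : Subset n} {j : ℕ} (Y-star : Star Y j) where

      leaf-subset : ∀ l → 0 < l → l ≤ t → mem Y l ≡ true → ∃ λ X → Segment X l 1 × X ⊆ₘ Y × Star (Y ─ X) j
      leaf-subset l 0<l l≤t l∈ =
        let (X , X-segment) = segment-subset l 1 0<l z<s (inj₁ refl) (subst (_≤ n) (+-comm 1 l) (s≤s (≤-trans l≤t (m≤m+n t k))))
        in X , X-segment , X⊆Y X X-segment ,
           Star-─-leaves Y j X Y-star (Segment⇒0∉ X-segment) (λ i i∈ → subst (_≤ t) (sym (Segment₁⇒≡ X-segment i∈)) l≤t)
        where
        X⊆Y : ∀ X → Segment X l 1 → X ⊆ₘ Y
        X⊆Y X X-segment i i∈ = subst (λ x → mem Y x ≡ true) (sym (Segment₁⇒≡ X-segment i∈)) l∈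

      tail-subset : ∀ d i → d + i ≡ j → 0 < i → ∃ λ X → Segment X (suc t + d) i × X ⊆ₘ Y × Star (Y ─ X) d
      tail-subset d i d+i≡j 0<i =
        let (X , X-segment) = segment-subset (suc t + d) i z<s 0<i (inj₂ (m≤m+n (suc t) d))
                                (subst (_≤ n) (sym top≡) (s≤s (+-monoʳ-≤ t (j≤k Y-star))))
        in X , X-segment , X⊆Y X X-segment , Star-─-tail Y j X d i Y-star X-segment d+i≡j
        where
        top≡ : suc t + d + i ≡ suc t + j
        top≡ = trans (+-assoc (suc t) d i) (cong (suc t +_) d+i≡j)
        X⊆Y : ∀ X → Segment X (suc t + d) i → X ⊆ₘ Y
        X⊆Y X X-segment p p∈ =
          let (1+t+d≤p , p<top) = Segment-bounds X-segment p∈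
          in trans (path∈ Y-star p (≤-trans (m≤m+n (suc t) d) 1+t+d≤p)) (<⇒<ᵇ≡true (subst (p <_) top≡ p<top))

      s : ℕ
      s = ∣ Y ∣ ∸ suc j

      ∣Y∣≡ : ∣ Y ∣ ≡ suc (s + j)
      ∣Y∣≡ = trans (Star⇒∣∣≡s+1+j Y j Y-star) (+-suc s j)

      leaf∈ : 0 < s → ∃ λ l → 0 < l × l ≤ t × mem Y l ≡ true
      leaf∈ 0<s = leafCount>0⇒leaf∈ Y (subst (0 <_) (leaves≡ Y j Y-star) 0<s)

      ∣Y∣≡s+1+d+i : ∀ {d i} → d + i ≡ j → ∣ Y ∣ ≡ s + suc d + i
      ∣Y∣≡s+1+d+i {d} {i} d+i≡j = trans (Star⇒∣∣≡s+1+j Y j Y-star) (trans (cong (λ j → s + suc j) (sym d+i≡j)) (sym (+-assoc s (suc d) i)))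

      star-option⁺ : ∀ {fuel} → ValuesBelow fuel ∣ Y ∣ → ∀ {w} → StarOption s j w → MoveValue N G (grundyF fuel (I N) G) Y w
      star-option⁺ {fuel} values (take-all s+j<N w≡0) = Y , move , trans w≡0 (sym (grundyF-Empty fuel (I N) G (Y ─ Y) Y─Y-empty))
        where
        Y─Y-empty : Empty (Y ─ Y)
        Y─Y-empty i = trans (mem-─ Y Y i) (∧-inverseʳ (mem Y i))
        move : Move N G Y Y
        move = record
          { X⊆Y = λ _ i∈ → i∈
          ; 0<∣X∣ = subst (0 <_) (sym ∣Y∣≡) z<s
          ; ∣X∣≤N = subst (_≤ N) (sym ∣Y∣≡) s+j<N
          ; X-connected = Star-connected Y j Y-star
          ; rest-connected = connectedᵇ-Empty (Y ─ Y) Y─Y-empty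
          }
      star-option⁺ {fuel} values (take-leaf s′ s≡1+s′ refl) =
        let (l , 0<l , l≤t , l∈) = leaf∈ (subst (0 <_) (sym s≡1+s′) z<s)
            (X , X-segment , X⊆Y , rest-star) = leaf-subset l 0<l l≤t l∈
            ∣Y∣≡′ = trans ∣Y∣≡ (trans (cong (λ s → suc (s + j)) s≡1+s′) (suc[1+s+j]≡s+1+j+1 s′ j))
        in subst (MoveValue N G (grundyF fuel (I N) G) Y) (cong (λ s → Q s j) (∣─∣∸≡ Y X s′ j 1 X⊆Y (Segment⇒∣∣≡ X l 1 X-segment) ∣Y∣≡′))
                 (take-segment values X l 1 j X-segment X⊆Y rest-star 0<N)
      star-option⁺ {fuel} values (take-tail i 0<i i≤N i≤j refl) =
        let d+i≡j = m∸n+n≡m i≤j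
            (X , X-segment , X⊆Y , rest-star) = tail-subset (j ∸ i) i d+i≡j 0<i
        in subst (MoveValue N G (grundyF fuel (I N) G) Y)
                 (cong (λ s → Q s (j ∸ i)) (∣─∣∸≡ Y X s (j ∸ i) i X⊆Y (Segment⇒∣∣≡ X _ i X-segment) (∣Y∣≡s+1+d+i d+i≡j)))
                 (take-segment values X _ i (j ∸ i) X-segment X⊆Y rest-star i≤N)
      star-option⁺ values (leave-path m 0<m m≤j s+j<N+m refl) =
        let (R , R-segment , R⊆Y , X-star) = tail-subset (j ∸ m) m (m∸n+n≡m m≤j) 0<m
        in leave-segment values R _ m (j ∸ m) R-segment R⊆Y X-star (subst (_≤ N + m) (sym ∣Y∣≡) s+j<N+m)
      star-option⁺ values (leave-leaf 0<s s+j≤N refl) =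
        let (l , 0<l , l≤t , l∈) = leaf∈ 0<s
            (R , R-segment , R⊆Y , X-star) = leaf-subset l 0<l l≤t l∈
        in leave-segment values R l 1 j R-segment R⊆Y X-star (subst₂ _≤_ (sym ∣Y∣≡) (+-comm 1 N) (s≤s s+j≤N))

      star-option⁻ : ∀ {fuel} → ValuesBelow fuel ∣ Y ∣ → ∀ {w} → MoveValue N G (grundyF fuel (I N) G) Y w → StarOption s j w
      star-option⁻ {fuel} values (X , move , refl) = by-shapes (shape R rest-connected) (shape X X-connected)
        where
        open Move move
        open ValuesBelow values
        R = Y ─ X
        R<Y : ∣ R ∣ < ∣ Y ∣
        R<Y = subst (∣ R ∣ <_) (∣─∣+∣∣≡∣∣ Y X X⊆Y) (m<m+n _ 0<∣X∣)
        sizes : ∀ {a m} → Segment R a m → m + ∣ X ∣ ≡ suc (s + j)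
        sizes {a} {m} R-segment = trans (cong (_+ ∣ X ∣) (sym (Segment⇒∣∣≡ R a m R-segment))) (trans (∣─∣+∣∣≡∣∣ Y X X⊆Y) ∣Y∣≡)
        0∈X⊎R : mem X 0 ≡ true ⊎ mem R 0 ≡ true
        0∈X⊎R with mem X 0 in 0∈X?
        ... | true = inj₁ refl
        ... | false = inj₂ (trans (mem-─ Y X 0) (trans (cong (λ b → mem Y 0 ∧ not b) 0∈X?) (trans (∧-identityʳ (mem Y 0)) (centre∈ Y-star))))
        ∈X⇒∉R : ∀ i → mem X i ≡ true → mem R i ≡ false
        ∈X⇒∉R i i∈X = trans (mem-─ Y X i) (trans (cong (λ b → mem Y i ∧ not b) i∈X) (∧-zeroʳ (mem Y i)))
        0∉X⇒0∈R : mem X 0 ≡ false → mem R 0 ≡ true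
        0∉X⇒0∈R 0∉X with 0∈X⊎R
        ... | inj₁ 0∈X = contradiction 0∉X (≡true⇒≢false 0∈X)
        ... | inj₂ 0∈R = 0∈R

        removed-leaf : ∀ a i → Segment X a i → a ≤ t → StarOption s j (grundyF fuel (I N) G R)
        removed-leaf a i X-segment a≤t = take-leaf (s ∸ 1) (sym (m+[n∸m]≡n 0<s)) (trans (star-value R j R-star R<Y) (cong (λ s → Q s j) rest-leaves))
          where
          i≡1 = leaf-Segment⇒m≡1 X-segment a≤t
          R-star : Star R j
          R-star = Star-─-leaves Y j X Y-star (Segment⇒0∉ X-segment)
                     (λ x x∈ → subst (_≤ t) (sym (Segment₁⇒≡ (subst (Segment X a) i≡1 X-segment) x∈)) a≤t)
          0<s : 0 < s
          0<s = subst (0 <_) (sym (leaves≡ Y j Y-star)) (leaf∈⇒leafCount>0 Y a (0<a X-segment) a≤t (X⊆Y a (Segment⇒a∈ X-segment)))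
          rest-leaves : ∣ R ∣ ∸ suc j ≡ s ∸ 1
          rest-leaves = ∣─∣∸≡ Y X (s ∸ 1) j 1 X⊆Y (trans (Segment⇒∣∣≡ X a i X-segment) i≡1)
                          (trans ∣Y∣≡ (trans (cong (λ s → suc (s + j)) (sym (m+[n∸m]≡n 0<s))) (suc[1+s+j]≡s+1+j+1 (s ∸ 1) j)))

        removed-tail : ∀ a i → Segment X a i → suc t ≤ a → PrefixClosed R → StarOption s j (grundyF fuel (I N) G R)
        removed-tail a i X-segment 1+t≤a R-prefix =
          take-tail i (0<m X-segment) i≤N i≤j (trans (star-value R d R-star R<Y) (cong₂ Q rest-leaves d≡j∸i))
          where
          ∣X∣≡i = Segment⇒∣∣≡ X a i X-segment
          i≤N = subst (_≤ N) ∣X∣≡i ∣X∣≤N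
          a+i≡top : a + i ≡ suc t + j
          a+i≡top with m≤n⇒m<n∨m≡n (Segment⊆Star⇒≤ X-segment Y-star X⊆Y 1+t≤a)
          ... | inj₂ a+i≡top = a+i≡top
          ... | inj₁ a+i<top = contradiction (∈X⇒∉R a (Segment⇒a∈ X-segment))
                                 (≡true⇒≢false (R-prefix a (t + j) 1+t≤a (<-≤-trans (m<m+n a (0<m X-segment)) a+i≤t+j) top∈R))
            where
            a+i≤t+j = ≤-pred a+i<top
            top∈R : mem R (t + j) ≡ true
            top∈R = trans (mem-─ Y X (t + j)) (cong₂ (λ a b → a ∧ not b)
                      (trans (path∈ Y-star (t + j) (≤-trans 1+t≤a (≤-trans (m≤m+n a i) a+i≤t+j))) (<⇒<ᵇ≡true (n<1+n (t + j))))
                      (trans (interval∈ X-segment (t + j)) (≥⇒intervalᵇ≡false {a} {i} a+i≤t+j)))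
          d = a ∸ suc t
          1+t+d≡a : suc t + d ≡ a
          1+t+d≡a = m+[n∸m]≡n 1+t≤a
          d+i≡j : d + i ≡ j
          d+i≡j = +-cancelˡ-≡ (suc t) _ _ (trans (sym (+-assoc (suc t) d i)) (trans (cong (_+ i) 1+t+d≡a) a+i≡top))
          R-star : Star R d
          R-star = Star-─-tail Y j X d i Y-star (subst (λ a → Segment X a i) (sym 1+t+d≡a) X-segment) d+i≡j
          i≤j = subst (i ≤_) d+i≡j (m≤n+m i d)
          d≡j∸i : d ≡ j ∸ i
          d≡j∸i = sym (trans (cong (_∸ i) (sym d+i≡j)) (m+n∸n≡m d i))
          rest-leaves : ∣ R ∣ ∸ suc d ≡ s
          rest-leaves = ∣─∣∸≡ Y X s d i X⊆Y ∣X∣≡i (∣Y∣≡s+1+d+i d+i≡j)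

        left-leaf : ∀ a m → Segment R a m → a ≤ t → StarOption s j (grundyF fuel (I N) G R)
        left-leaf a m R-segment a≤t = leave-leaf 0<s s+j≤N (trans (segment-value R a m R-segment R<Y) (cong (_% suc N) m≡1))
          where
          m≡1 = leaf-Segment⇒m≡1 R-segment a≤t
          0<s : 0 < s
          0<s = subst (0 <_) (sym (leaves≡ Y j Y-star)) (leaf∈⇒leafCount>0 Y a (0<a R-segment) a≤t (─-⊆ Y X a (Segment⇒a∈ R-segment)))
          s+j≤N : s + j ≤ N
          s+j≤N = subst (_≤ N) (suc-injective (trans (cong (_+ ∣ X ∣) (sym m≡1)) (sizes R-segment))) ∣X∣≤N

        left-path : ∀ a m → Segment R a m → suc t ≤ a → StarOption s j (grundyF fuel (I N) G R)
        left-path a m R-segment 1+t≤a = leave-path m (0<m R-segment) m≤j s+j<N+m (segment-value R a m R-segment R<Y)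
          where
          m≤j = +-cancelˡ-≤ (suc t) m j (≤-trans (+-monoˡ-≤ m 1+t≤a) (Segment⊆Star⇒≤ R-segment Y-star (─-⊆ Y X) 1+t≤a))
          s+j<N+m : s + j < N + m
          s+j<N+m = subst₂ _≤_ (sizes R-segment) (+-comm m N) (+-monoʳ-≤ m ∣X∣≤N)

        by-shapes : Shape R → Shape X → StarOption s j (grundyF fuel (I N) G R)
        by-shapes (empty R-empty) _ =
          take-all (subst (_≤ N) (trans (cong (_+ ∣ X ∣) (sym (Empty⇒∣∣≡0 R R-empty))) (trans (∣─∣+∣∣≡∣∣ Y X X⊆Y) ∣Y∣≡)) ∣X∣≤N)
                   (grundyF-Empty fuel (I N) G R R-empty)
        by-shapes (star 0∈R _) (empty X-empty) = contradiction (Empty⇒∣∣≡0 X X-empty) (≢-sym (<⇒≢ 0<∣X∣))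
        by-shapes (star 0∈R _) (star 0∈X _) = contradiction (∈X⇒∉R 0 0∈X) (≡true⇒≢false 0∈R)
        by-shapes (star _ R-prefix) (segment a i X-segment) with a ≤? t
        ... | yes a≤t = removed-leaf a i X-segment a≤t
        ... | no a≰t = removed-tail a i X-segment (≰⇒> a≰t) R-prefix
        by-shapes (segment a m R-segment) (star _ _) with a ≤? t
        ... | yes a≤t = left-leaf a m R-segment a≤t
        ... | no a≰t = left-path a m R-segment (≰⇒> a≰t)
        by-shapes (segment _ _ R-segment) (empty X-empty) = contradiction (Segment⇒0∉ R-segment) (≡true⇒≢false (0∉X⇒0∈R (X-empty 0)))
        by-shapes (segment _ _ R-segment) (segment _ _ X-segment) =
          contradiction (Segment⇒0∉ R-segment) (≡true⇒≢false (0∉X⇒0∈R (Segment⇒0∉ X-segment)))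

    module SegmentMoves {Y : Subset n} {a m : ℕ} (Y-segment : Segment Y a m) where

      ∣Y∣≡m : ∣ Y ∣ ≡ m
      ∣Y∣≡m = Segment⇒∣∣≡ Y a m Y-segment

      segment-option⁻ : ∀ {fuel} → ValuesBelow fuel ∣ Y ∣ → ∀ {w} → MoveValue N G (grundyF fuel (I N) G) Y w → PathOption m w
      segment-option⁻ {fuel} values (X , move , refl) = by-shape (shape R rest-connected)
        where
        open Move move
        open ValuesBelow values
        R = Y ─ X
        sizes : ∣ R ∣ + ∣ X ∣ ≡ m
        sizes = trans (∣─∣+∣∣≡∣∣ Y X X⊆Y) ∣Y∣≡m
        by-shape : Shape R → PathOption m (grundyF fuel (I N) G R)
        by-shape (empty R-empty) = take-all (subst (_≤ N) (trans (cong (_+ ∣ X ∣) (sym (Empty⇒∣∣≡0 R R-empty))) sizes) ∣X∣≤N)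
                                            (grundyF-Empty fuel (I N) G R R-empty)
        by-shape (star 0∈R _) = contradiction (Segment⇒0∉ Y-segment) (≡true⇒≢false (─-⊆ Y X 0 0∈R))
        by-shape (segment lo m′ R-segment) =
          take-end ∣ X ∣ 0<∣X∣ ∣X∣≤N X<m (trans (segment-value R lo m′ R-segment R<Y) (cong (_% suc N) m′≡m∸∣X∣))
          where
          sizes′ : m′ + ∣ X ∣ ≡ m
          sizes′ = trans (cong (_+ ∣ X ∣) (sym (Segment⇒∣∣≡ R lo m′ R-segment))) sizes
          X<m : ∣ X ∣ < m
          X<m = subst (∣ X ∣ <_) (trans (+-comm ∣ X ∣ m′) sizes′) (m<m+n ∣ X ∣ (0<m R-segment))
          m′≡m∸∣X∣ : m′ ≡ m ∸ ∣ X ∣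
          m′≡m∸∣X∣ = sym (trans (cong (_∸ ∣ X ∣) (sym sizes′)) (m+n∸n≡m m′ ∣ X ∣))
          R<Y : ∣ R ∣ < ∣ Y ∣
          R<Y = subst₂ _<_ (sym (Segment⇒∣∣≡ R lo m′ R-segment)) (sym ∣Y∣≡m) (subst (m′ <_) sizes′ (m<m+n m′ 0<∣X∣))

      segment-option⁺ : ∀ {fuel} → ValuesBelow fuel ∣ Y ∣ → ∀ {w} → PathOption m w → MoveValue N G (grundyF fuel (I N) G) Y w
      segment-option⁺ {fuel} values (take-all m≤N w≡0) = Y , move , trans w≡0 (sym (grundyF-Empty fuel (I N) G (Y ─ Y) Y─Y-empty))
        where
        Y─Y-empty : Empty (Y ─ Y)
        Y─Y-empty i = trans (mem-─ Y Y i) (∧-inverseʳ (mem Y i))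
        move : Move N G Y Y
        move = record
          { X⊆Y = λ _ i∈ → i∈
          ; 0<∣X∣ = subst (0 <_) (sym ∣Y∣≡m) (0<m Y-segment)
          ; ∣X∣≤N = subst (_≤ N) (sym ∣Y∣≡m) m≤N
          ; X-connected = Segment-connected Y a m Y-segment
          ; rest-connected = connectedᵇ-Empty (Y ─ Y) Y─Y-empty
          }
      segment-option⁺ {fuel} values (take-end i 0<i i≤N i<m w≡) = X , move , trans w≡ (sym (segment-value R a (m ∸ i) R-segment R<Y))
        where
        open ValuesBelow values
        b = a + (m ∸ i)
        b+i≡a+m : b + i ≡ a + m
        b+i≡a+m = trans (+-assoc a (m ∸ i) i) (cong (a +_) (m∸n+n≡m (<⇒≤ i<m)))
        1+t≤a : suc t ≤ a
        1+t≤a with leaf⊎path Y-segment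
        ... | inj₁ refl = contradiction (<-≤-trans i<m 0<i) (<-irrefl refl)
        ... | inj₂ 1+t≤a = 1+t≤a
        X-exists = segment-subset b i (≤-trans (0<a Y-segment) (m≤m+n a _)) 0<i (inj₂ (≤-trans 1+t≤a (m≤m+n a _)))
                                  (subst (_≤ n) (sym b+i≡a+m) (a+m≤n Y-segment))
        X = proj₁ X-exists
        X-segment = proj₂ X-exists
        R = Y ─ X
        X⊆Y : X ⊆ₘ Y
        X⊆Y p p∈ = let (b≤p , p<b+i) = Segment-bounds X-segment p∈
                   in trans (interval∈ Y-segment p) (intervalᵇ≡true (≤-trans (m≤m+n a _) b≤p) (subst (p <_) b+i≡a+m p<b+i))
        R-segment : Segment R a (m ∸ i)
        R-segment = record
          { 0<a = 0<a Y-segment ; 0<m = m<n⇒0<n∸m i<m ; leaf⊎path = inj₂ 1+t≤a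
          ; a+m≤n = ≤-trans (+-monoʳ-≤ a (m∸n≤m m i)) (a+m≤n Y-segment)
          ; interval∈ = λ p → begin
              mem (Y ─ X) p                                              ≡⟨ mem-─ Y X p ⟩
              mem Y p ∧ not (mem X p)                                    ≡⟨ cong₂ (λ u v → u ∧ not v) (interval∈ Y-segment p) (interval∈ X-segment p) ⟩
              ((a ≤ᵇ p) ∧ (p <ᵇ a + m)) ∧ not (intervalᵇ b i p)          ≡⟨ ∧-assoc (a ≤ᵇ p) _ _ ⟩
              (a ≤ᵇ p) ∧ ((p <ᵇ a + m) ∧ not (intervalᵇ b i p))          ≡⟨ cong (λ c → (a ≤ᵇ p) ∧ ((p <ᵇ c) ∧ not (intervalᵇ b i p))) b+i≡a+m ⟨
              (a ≤ᵇ p) ∧ ((p <ᵇ b + i) ∧ not (intervalᵇ b i p))          ≡⟨ cong ((a ≤ᵇ p) ∧_) (<ᵇ-∧-not-intervalᵇ b i p) ⟩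
              intervalᵇ a (m ∸ i) p                                      ∎
          }
          where open ≡-Reasoning
        ∣X∣≡i = Segment⇒∣∣≡ X b i X-segment
        R<Y : ∣ R ∣ < ∣ Y ∣
        R<Y = subst (∣ R ∣ <_) (∣─∣+∣∣≡∣∣ Y X X⊆Y) (m<m+n _ (subst (0 <_) (sym ∣X∣≡i) 0<i))
        move : Move N G Y X
        move = record
          { X⊆Y = X⊆Y
          ; 0<∣X∣ = subst (0 <_) (sym ∣X∣≡i) 0<i
          ; ∣X∣≤N = subst (_≤ N) (sym ∣X∣≡i) i≤N
          ; X-connected = Segment-connected X b i X-segment
          ; rest-connected = Segment-connected R a (m ∸ i) R-segment
          }

module StarPathGrundyValues (N : ℕ) (0<N : 0 < N) where

  open Mex
  open Recurrence
  open Booleans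
  open Subsets
  open Game
  open Shapes
  open Correspondence
  open import Data.Nat
  open import Data.Nat.Properties
  open import Data.Nat.DivMod using (_%_)
  open import Data.Nat.Induction using (<-rec)
  open import Data.Fin.Subset using (Subset; inside; ∣_∣)
  open import Data.Fin.Subset.Properties using (∣⊤∣≡n)
  open import Data.Vec using (replicate)
  open import Data.Product using (_×_; _,_; proj₁; proj₂)
  open import Function using (mk⇔)
  open import Relation.Binary.PropositionalEquality

  Q : ℕ → ℕ → ℕ
  Q s j = 𝒢 (I N) (starPath s j)

  open StarRecurrence N Q using (StarOption)
  open PathRecurrence N using (path-IsMex)

  -- The induction ranges over all star-path graphs at once: identifying the value of a star position
  -- with Q s j goes through the full graph S_{1^s} ⊕ P_j (Q-IsMex-from).
  CorrectAtSize : ℕ → Set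
  CorrectAtSize size = ∀ t k fuel → size < fuel → ∀ (Y : Subset (suc (t + k))) → ∣ Y ∣ ≡ size →
    (∀ j → StarPath.Star t k Y j → grundyF fuel (I N) (starPath t k) Y ≡ Q (size ∸ suc j) j) ×
    (∀ a m → StarPath.Segment t k Y a m → grundyF fuel (I N) (starPath t k) Y ≡ m % suc N)

  CorrectBelow : ℕ → Set
  CorrectBelow size = ∀ size′ → size′ < size → CorrectAtSize size′

  values-below : ∀ {size} t k fuel → size ≤ fuel → CorrectBelow size → StarPathValues.ValuesBelow N 0<N Q t k fuel size
  values-below t k fuel size≤fuel correct = record
    { star-value = λ Z j Z-star Z<size → proj₁ (correct ∣ Z ∣ Z<size t k fuel (<-≤-trans Z<size size≤fuel) Z refl) j Z-star
    ; segment-value = λ Z a m Z-segment Z<size → proj₂ (correct ∣ Z ∣ Z<size t k fuel (<-≤-trans Z<size size≤fuel) Z refl) a m Z-segment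
    }

  Q-IsMex-from : ∀ s j → CorrectBelow (suc (s + j)) → IsMex (StarOption s j) (Q s j)
  Q-IsMex-from s j correct = subst (λ s′ → IsMex (StarOption s′ j) (Q s j)) leaves≡s
    (IsMex-resp-⇔ (λ w → mk⇔ (star-option⁻ values) (star-option⁺ values)) (grundyF-IsMex (suc (s + j)) N (starPath s j) Full))
    where
    open StarPath s j
    open StarPathValues N 0<N Q s j
    Full : Subset n
    Full = replicate n inside
    Full-star : Star Full j
    Full-star = record { centre∈ = refl ; j≤k = ≤-refl ; path∈ = λ i _ → mem-inside n i }
    open StarMoves Full-star using (star-option⁻; star-option⁺)
    values : ValuesBelow (suc (s + j)) ∣ Full ∣
    values = values-below s j n (≤-reflexive (∣⊤∣≡n n)) (subst CorrectBelow (sym (∣⊤∣≡n n)) correct)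
    leaves≡s : ∣ Full ∣ ∸ suc j ≡ s
    leaves≡s = trans (cong (_∸ suc j) (trans (∣⊤∣≡n n) (sym (+-suc s j)))) (m+n∸n≡m s (suc j))

  correct-at : ∀ size → CorrectBelow size → CorrectAtSize size
  correct-at size below t k (suc fuel) size<1+fuel Y ∣Y∣≡size = star-case , segment-case
    where
    open StarPath t k
    open StarPathValues N 0<N Q t k
    values : ValuesBelow fuel ∣ Y ∣
    values = values-below t k fuel (subst (_≤ fuel) (sym ∣Y∣≡size) (≤-pred size<1+fuel)) (subst CorrectBelow (sym ∣Y∣≡size) below)
    star-case : ∀ j → Star Y j → grundyF (suc fuel) (I N) G Y ≡ Q (size ∸ suc j) j
    star-case j Y-star = trans (IsMex-unique grundy-IsMex Q-IsMex) (cong (λ z → Q (z ∸ suc j) j) ∣Y∣≡size)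
      where
      open StarMoves Y-star using (s; ∣Y∣≡; star-option⁻; star-option⁺)
      grundy-IsMex : IsMex (StarOption s j) (grundyF (suc fuel) (I N) G Y)
      grundy-IsMex = IsMex-resp-⇔ (λ w → mk⇔ (star-option⁻ values) (star-option⁺ values)) (grundyF-IsMex fuel N G Y)
      Q-IsMex : IsMex (StarOption s j) (Q s j)
      Q-IsMex = Q-IsMex-from s j λ size′ size′<1+s+j → below size′ (subst (size′ <_) (trans (sym ∣Y∣≡) ∣Y∣≡size) size′<1+s+j)
    segment-case : ∀ a m → Segment Y a m → grundyF (suc fuel) (I N) G Y ≡ m % suc N
    segment-case a m Y-segment = IsMex-unique
      (IsMex-resp-⇔ (λ w → mk⇔ (segment-option⁻ values) (segment-option⁺ values)) (grundyF-IsMex fuel N G Y))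
      (path-IsMex m (0<m Y-segment))
      where open SegmentMoves Y-segment using (segment-option⁻; segment-option⁺)

  correct : ∀ size → CorrectAtSize size
  correct = <-rec CorrectAtSize λ size correct-below → correct-at size λ size′ size′<size → correct-below size′<size

  Q-IsMex : ∀ s j → IsMex (StarOption s j) (Q s j)
  Q-IsMex s j = Q-IsMex-from s j λ size′ _ → correct size′

proposition8 : (t N k : ℕ) → 1 ≤ t → 3 ≤ N →
    𝒢 (I N) (starPath t k) ≡ 𝒢 (I N) (starPath t (k % suc N))
proposition8 t N k _ 3≤N = Q-mod t k
  where
  0<N : 0 < N
  0<N = ≤-trans (s≤s z≤n) 3≤N
  open StarPathGrundyValues N 0<N using (Q; Q-IsMex)
  open Recurrence.StarRecurrence.Periodicity N Q 0<N Q-IsMex using (Q-mod)
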